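{- Consider $(G_1,G_2')$ drawn from the attributed Erdős–Rényi graph pair model $\mathcal{G}(n,q_{\mathrm u},\rho_{\mathrm u};m,q_{\mathrm a},\rho_{\mathrm a})$ with the hidden permutation $\Pi^*$ equal to the identity. For any positive integer $k$ and any pair of users $(i,j)\in[n]\times[n]$, $$\mathsf E[\Phi_{ij}]=\binom{m}{k}(\rho_{\mathrm u}\sigma_{\mathrm u}^2)^k(\rho_{\mathrm a}\sigma_{\mathrm a}^2)^k\binom{n-1}{k}k!\,\mathbb 1\{i=j\}.$$ Moreover, if $k=\Theta(1)$, then $\mathsf E[\Phi_{ii}]=\Omega\big(m^kn^k(\rho_{\mathrm u}\sigma_{\mathrm u}^2)^k(\rho_{\mathrm a}\sigma_{\mathrm a}^2)^k\big)$.
   Context: Model (with $\Pi^*=\mathrm{id}$): users $[n]$, attributes $a_1,\dots,a_m$; graphs $G_1,G_2'$ on $[n]\cup\{a_1,\dots,a_m\}$ with only user–user and user–attribute edges. For each unordered pair of distinct users $\{i,j\}$, $(\mathbb 1\{\{i,j\}\in G_1\},\mathbb 1\{\{i,j\}\in G_2'\})$ is a pair of Bernoulli$(q_{\mathrm u})$ variables with correlation coefficient $\rho_{\mathrm u}$; for each user $i$ and attribute $a_l$, $(\mathbb 1\{\{i,a_l\}\in G_1\},\mathbb 1\{\{i,a_l\}\in G_2'\})$ is a pair of Bernoulli$(q_{\mathrm a})$ variables with correlation coefficient $\rho_{\mathrm a}$; all pairs independent. $\sigma_{\mathrm u}^2=q_{\mathrm u}(1-q_{\mathrm u})$, $\sigma_{\mathrm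 a}^2=q_{\mathrm a}(1-q_{\mathrm a})$. Similarity score: let $A^{\mathrm u},A^{\mathrm a}$ (resp. $B^{\mathrm u},B^{\mathrm a}$) be the user–user ($n\times n$) and user–attribute ($n\times m$) adjacency matrices of $G_1$ (resp. $G_2'$), and $\tilde A^{\mathrm u}=A^{\mathrm u}-q_{\mathrm u}$, $\tilde A^{\mathrm a}=A^{\mathrm a}-q_{\mathrm a}$, $\tilde B^{\mathrm u}=B^{\mathrm u}-q_{\mathrm u}$, $\tilde B^{\mathrm a}=B^{\mathrm a}-q_{\mathrm a}$ entrywise. For a graph $S$ on vertices in $[n]\cup\{a_1,\dots,a_m\}$ with user–user and user–attribute edges, $\omega_1(S)=\prod_{e}\tilde A^{\mathrm u}_e\prod_f\tilde A^{\mathrm a}_f$, $\omega_2(S)=\prod_e\tilde B^{\mathrm u}_e\prod_f\tilde B^{\mathrm a}_f$ (products over the user–user edges $e$ and user–attribute edges $f$ of $S$). For $i\in[n]$ and $\mathcal A\subseteq\{a_1,\dots,a_m\}$, $|\mathcal A|=k$, $\mathcal G_{i,\mathcal A}$ is the set of trees made of $k$ paths $i-u_t-\alpha_t$ ($t=1,\dots,k$) with $u_1,\dots,u_k$ distinct users in $[n]\setminus\{i\}$ and $\{\alpha_1,\dots,\alpha_k\}=\mathcal A$. $W_{i,\mathcal A}(G_1)=\sum_{S\in\mathcal G_{i,\mathcal A}}\omega_1(S)$, $W_{j,\mathcal A}(G_2')=\sum_{S\in\mathcal G_{j,\mathcal A}}\omega_2(S)$, and $\Phi_{ij}=\sum_{\mathcal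 A:|\mathcal A|=k}W_{i,\mathcal A}(G_1)W_{j,\mathcal A}(G_2')$.
   Formalization: The edge probabilities $q_{\mathrm u}$, $q_{\mathrm a}$ and the correlation coefficients $\rho_{\mathrm u}$, $\rho_{\mathrm a}$ take rational values. -}

module Defs where

open import Data.Bool using (Bool; true; false; if_then_else_)
open import Data.Nat as ℕ using (ℕ; zero; suc)
open import Data.Fin as Fin using (Fin; zero; suc; _≟_; _<?_)
open import Data.Fin.Properties using (all?)
open import Data.Product using (_×_; _,_; proj₁; proj₂)
open import Data.List using (List; []; _∷_)
open import Data.Integer using (+_)
open import Data.Rational using (ℚ; 0ℚ; 1ℚ; _+_; _*_; _-_; _/_)
open import Relation.Nullary using (Dec; yes; no; ¬_)
open import Relation.Nullary.Decidable using (_→-dec_; ¬?)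
open import Relation.Binary.PropositionalEquality using (_≡_)

ℕ→ℚ : ℕ → ℚ
ℕ→ℚ n = + n / 1

_^ℚ_ : ℚ → ℕ → ℚ
x ^ℚ zero  = 1ℚ
x ^ℚ suc k = x * (x ^ℚ k)

𝟙 : ∀ {a} {P : Set a} → Dec P → ℚ
𝟙 (yes _) = 1ℚ
𝟙 (no  _) = 0ℚ

-- outcome of one edge slot: (indicator in G₁ , indicator in G₂')
Out : Set
Out = Bool × Bool

Dist : Set
Dist = List (Out × ℚ)

σ² : ℚ → ℚ
σ² q = q * (1ℚ - q)

-- Joint law of a pair of Bernoulli(q) variables with correlation
-- coefficient ρ, i.e. covariance ρ σ².
corrBern : (q ρ : ℚ) → Dist
corrBern q ρ =
    ((true  , true ) , q * q + ρ * σ² q)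
  ∷ ((true  , false) , σ² q - ρ * σ² q)
  ∷ ((false , true ) , σ² q - ρ * σ² q)
  ∷ ((false , false) , (1ℚ - q) * (1ℚ - q) + ρ * σ² q)
  ∷ []

ValidParams : (q ρ : ℚ) → Set
ValidParams q ρ =
  (0ℚ Data.Rational.≤ q) × (q Data.Rational.≤ 1ℚ)
  × (0ℚ Data.Rational.≤ q * q + ρ * σ² q)
  × (0ℚ Data.Rational.≤ σ² q - ρ * σ² q)
  × (0ℚ Data.Rational.≤ (1ℚ - q) * (1ℚ - q) + ρ * σ² q)

-- point mass (used for coordinates that are not edge slots)
δ : Out → Dist
δ o = (o , 1ℚ) ∷ []

E₀ : Dist → (Out → ℚ) → ℚ
E₀ []             f = 0ℚ
E₀ ((o , p) ∷ ds) f = p * f o + E₀ ds f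

cons : ∀ {k} {A : Fin (suc k) → Set} → A zero → ((i : Fin k) → A (suc i)) → (i : Fin (suc k)) → A i
cons a g zero    = a
cons a g (suc i) = g i

E₁ : (b : ℕ) → (Fin b → Dist) → ((Fin b → Out) → ℚ) → ℚ
E₁ zero    μ f = f (λ ())
E₁ (suc b) μ f = E₀ (μ zero) (λ o → E₁ b (λ i → μ (suc i)) (λ g → f (cons o g)))

E₂ : (a b : ℕ) → (Fin a → Fin b → Dist) → ((Fin a → Fin b → Out) → ℚ) → ℚ
E₂ zero    b μ f = f (λ ())
E₂ (suc a) b μ f =
  E₁ b (μ zero) (λ row → E₂ a b (λ i → μ (suc i)) (λ rest → f (cons row rest)))

record Params : Set where
  constructor params
  field
    qu ρu qa ρa : ℚ
open Params public

-- A realisation: user–user slots are the entries (i , j) with i < j of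
-- the first component (other entries are unused and deterministic);
-- user–attribute slots are all entries of the second component.
Config : ℕ → ℕ → Set
Config n m = (Fin n → Fin n → Out) × (Fin n → Fin m → Out)

μu : ∀ {n} → ℚ → ℚ → Fin n → Fin n → Dist
μu q ρ i j with i <? j
... | yes _ = corrBern q ρ
... | no  _ = δ (false , false)

𝔼 : (n m : ℕ) → Params → (Config n m → ℚ) → ℚ
𝔼 n m θ F =
  E₂ n n (μu (qu θ) (ρu θ)) (λ U →
  E₂ n m (λ _ _ → corrBern (qa θ) (ρa θ)) (λ Aa → F (U , Aa)))

-- adjacency of users i , j (unordered pair) in G₁ (proj₁) / G₂' (proj₂)
uuEdge : ∀ {n} → (Out → Bool) → (Fin n → Fin n → Out) → Fin n → Fin n → Bool
uuEdge π U i j with i <? j | j <? i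
... | yes _ | _     = π (U i j)
... | no  _ | yes _ = π (U j i)
... | no  _ | no  _ = false

b2q : Bool → ℚ
b2q true  = 1ℚ
b2q false = 0ℚ

-- centred adjacency entries  Ã^u , Ã^a  (π = proj₁)  and  B̃^u , B̃^a  (π = proj₂)
centU : ∀ {n m} → Params → (Out → Bool) → Config n m → Fin n → Fin n → ℚ
centU θ π (U , _) i j = b2q (uuEdge π U i j) - qu θ

centA : ∀ {n m} → Params → (Out → Bool) → Config n m → Fin n → Fin m → ℚ
centA θ π (_ , Aa) i l = b2q (π (Aa i l)) - qa θ

ΣFin : (k : ℕ) → (Fin k → ℚ) → ℚ
ΣFin zero    f = 0ℚ
ΣFin (suc k) f = f zero + ΣFin k (λ i → f (suc i))

ΠFin : (k : ℕ) → (Fin k → ℚ) → ℚ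
ΠFin zero    f = 1ℚ
ΠFin (suc k) f = f zero * ΠFin k (λ i → f (suc i))

ΣFun : (k n : ℕ) → ((Fin k → Fin n) → ℚ) → ℚ
ΣFun zero    n F = F (λ ())
ΣFun (suc k) n F = ΣFin n (λ x → ΣFun k n (λ g → F (cons x g)))

-- a k-subset 𝒜 of {a₁,…,a_m} is enumerated uniquely by its increasing listing α
Increasing : ∀ {k m} → (Fin k → Fin m) → Set
Increasing {k} α = ∀ s t → s Fin.< t → α s Fin.< α t

increasing? : ∀ {k m} (α : Fin k → Fin m) → Dec (Increasing α)
increasing? α = all? λ s → all? λ t → (s <? t) →-dec (α s <? α t)

-- a tree S ∈ 𝒢_{i,𝒜} (𝒜 listed by α) is the same as an injective choice
-- u : Fin k → [n] ∖ {i}, the path i - u t - α t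
TreeChoice : ∀ {k n} → Fin n → (Fin k → Fin n) → Set
TreeChoice {k} i u = (∀ s t → u s ≡ u t → s ≡ t) × (∀ t → ¬ (u t ≡ i))

treeChoice? : ∀ {k n} (i : Fin n) (u : Fin k → Fin n) → Dec (TreeChoice i u)
treeChoice? i u =
  (all? λ s → all? λ t → (u s ≟ u t) →-dec (s ≟ t))
  Relation.Nullary.Decidable.×-dec (all? λ t → ¬? (u t ≟ i))

ωTree : ∀ {k n m} → Params → (Out → Bool) → Config n m →
        Fin n → (Fin k → Fin m) → (Fin k → Fin n) → ℚ
ωTree {k} θ π G i α u =
  ΠFin k (λ t → centU θ π G i (u t) * centA θ π G (u t) (α t))

W : ∀ {n m} (k : ℕ) → Params → (Out → Bool) → Config n m →
    Fin n → (Fin k → Fin m) → ℚ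
W {n} k θ π G i α = ΣFun k n (λ u → 𝟙 (treeChoice? i u) * ωTree θ π G i α u)

Φ : ∀ {n m} (k : ℕ) → Params → Fin n → Fin n → Config n m → ℚ
Φ {n} {m} k θ i j G =
  ΣFun k m (λ α → 𝟙 (increasing? α) * (W k θ proj₁ G i α * W k θ proj₂ G j α))

-- Expanding Φᵢⱼ by linearity of 𝔼 gives a sum, over k-subsets 𝒜 (listed increasingly) and pairs of
-- trees S ∈ 𝒢ᵢ,𝒜, S′ ∈ 𝒢ⱼ,𝒜, of 𝔼[ω₁(S) ω₂(S′)]. All slots are independent centred pairs, so a slot
-- used by only one of S, S′ kills the term: if the first paths i–u₀–α₀ and j–v₀–α₀ have u₀ ≠ v₀ the
-- attribute slot (u₀, α₀) is alone, and if u₀ = v₀ but i ≠ j the edge {i, u₀} is. So only S = S′ with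
-- i = j survives, path by path, each shared path contributing ρᵤσᵤ² · ρₐσₐ². There are (n−1)ₖ such
-- trees (falling factorial) and C(m, k) sets 𝒜 (hockey-stick identity). The lower bound is
-- Mₖ ≥ (M/2)ᵏ for M ≥ 2k. Everything is a polynomial identity in q and ρ.

{-# OPTIONS --safe #-}
module Submission where

open import Defs
open import Data.Nat using (ℕ; _≥_; _∸_; _!; NonZero)
open import Data.Nat.Combinatorics using (_C_)
open import Data.Fin using (Fin; _≟_)
open import Data.Product using (_×_; Σ; _,_)
open import Data.Rational using (ℚ; 0ℚ; _*_; _≤_; _<_; ∣_∣)
open import Relation.Binary.PropositionalEquality using (_≡_)

import Data.Bool as Bool
open import Data.Empty using (⊥-elim)
open import Data.Fin as Fin using (zero; suc; toℕ)
import Data.Fin.Properties as Finₚ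
open import Data.Integer as ℤ using (+_)
import Data.Integer.Properties as ℤₚ
open import Data.List using (List; []; _∷_; length)
open import Data.List.Membership.Propositional using (_∉_)
open import Data.List.Relation.Unary.All using ([])
open import Data.List.Relation.Unary.All.Properties.Core using (All¬⇒¬Any; ¬Any⇒All¬)
open import Data.List.Relation.Unary.Any using (here; there; any?)
open import Data.List.Relation.Unary.Unique.Propositional using (Unique; []; _∷_)
import Data.Nat as ℕ
open import Data.Nat using (zero; suc)
import Data.Nat.Combinatorics as Combinatorics
open import Data.Nat.Combinatorics using (nCk≡nPk/k!; nPk≡n!/[n∸k]!; k>n⇒nCk≡0; nCk+nC[k+1]≡[n+1]C[k+1])
open import Data.Nat.Combinatorics.Base using (_P′_)
open import Data.Nat.Combinatorics.Specification using (nP′k≡n!/[n∸k]!; nP′k≡n[n∸1P′k∸1]; k!∣nP′k)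
import Data.Nat.Coprimality as Coprime
open import Data.Nat.DivMod using (m/n*n≡m)
import Data.Nat.Properties as ℕₚ
import Data.Nat.Tactic.RingSolver as ℕ-Ring
open import Data.Product using (proj₁; proj₂)
import Data.Rational as ℚ
open import Data.Rational using (1ℚ; _+_; _-_; toℚᵘ; 1/_)
import Data.Rational.Properties as ℚₚ
open import Data.Rational.Solver using (module +-*-Solver)
import Data.Rational.Unnormalised as ℚᵘ
import Data.Rational.Unnormalised.Properties as ℚᵘₚ
open import Data.Sum using (_⊎_; inj₁; inj₂)
open import Relation.Binary.Definitions using (tri<; tri≈; tri>)
open import Relation.Binary.PropositionalEquality
  using (refl; sym; trans; cong; cong₂; subst; subst₂; _≢_; module ≡-Reasoning)
open import Relation.Nullary using (Dec; yes; no; ¬_; ¬?)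

open +-*-Solver using (solve; _:+_; _:*_; _:-_; _:=_; con)

ℕ→ℚ-toℚᵘ : ∀ n → toℚᵘ (ℕ→ℚ n) ≡ ℚᵘ.mkℚᵘ (+ n) 0
ℕ→ℚ-toℚᵘ n = cong toℚᵘ (ℚₚ.normalize-coprime (Coprime.sym (Coprime.1-coprimeTo n)))

ℕ→ℚ-homo-+ : ∀ a b → ℕ→ℚ (a ℕ.+ b) ≡ ℕ→ℚ a + ℕ→ℚ b
ℕ→ℚ-homo-+ a b = ℚₚ.toℚᵘ-injective (begin
  toℚᵘ (ℕ→ℚ (a ℕ.+ b))                  ≡⟨ ℕ→ℚ-toℚᵘ (a ℕ.+ b) ⟩
  ℚᵘ.mkℚᵘ (+ (a ℕ.+ b)) 0               ≈⟨ ℚᵘ.*≡* (cong (λ z → z ℤ.* + 1) numerators) ⟩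
  ℚᵘ.mkℚᵘ (+ a) 0 ℚᵘ.+ ℚᵘ.mkℚᵘ (+ b) 0  ≡⟨ cong₂ ℚᵘ._+_ (ℕ→ℚ-toℚᵘ a) (ℕ→ℚ-toℚᵘ b) ⟨
  toℚᵘ (ℕ→ℚ a) ℚᵘ.+ toℚᵘ (ℕ→ℚ b)        ≈⟨ ℚₚ.toℚᵘ-homo-+ (ℕ→ℚ a) (ℕ→ℚ b) ⟨
  toℚᵘ (ℕ→ℚ a + ℕ→ℚ b)                  ∎)
  where
  open ℚᵘₚ.≃-Reasoning
  numerators : + (a ℕ.+ b) ≡ + a ℤ.* + 1 ℤ.+ + b ℤ.* + 1
  numerators = trans (ℤₚ.pos-+ a b) (sym (cong₂ ℤ._+_ (ℤₚ.*-identityʳ (+ a)) (ℤₚ.*-identityʳ (+ b))))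

ℕ→ℚ-homo-* : ∀ a b → ℕ→ℚ (a ℕ.* b) ≡ ℕ→ℚ a * ℕ→ℚ b
ℕ→ℚ-homo-* a b = ℚₚ.toℚᵘ-injective (begin
  toℚᵘ (ℕ→ℚ (a ℕ.* b))                  ≡⟨ ℕ→ℚ-toℚᵘ (a ℕ.* b) ⟩
  ℚᵘ.mkℚᵘ (+ (a ℕ.* b)) 0               ≈⟨ ℚᵘ.*≡* (cong (λ z → z ℤ.* + 1) (ℤₚ.pos-* a b)) ⟩
  ℚᵘ.mkℚᵘ (+ a) 0 ℚᵘ.* ℚᵘ.mkℚᵘ (+ b) 0  ≡⟨ cong₂ ℚᵘ._*_ (ℕ→ℚ-toℚᵘ a) (ℕ→ℚ-toℚᵘ b) ⟨
  toℚᵘ (ℕ→ℚ a) ℚᵘ.* toℚᵘ (ℕ→ℚ b)        ≈⟨ ℚₚ.toℚᵘ-homo-* (ℕ→ℚ a) (ℕ→ℚ b) ⟨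
  toℚᵘ (ℕ→ℚ a * ℕ→ℚ b)                  ∎)
  where open ℚᵘₚ.≃-Reasoning

ℕ→ℚ-homo-^ : ∀ a k → ℕ→ℚ a ^ℚ k ≡ ℕ→ℚ (a ℕ.^ k)
ℕ→ℚ-homo-^ a zero    = refl
ℕ→ℚ-homo-^ a (suc k) = trans (cong (ℕ→ℚ a *_) (ℕ→ℚ-homo-^ a k)) (sym (ℕ→ℚ-homo-* a (a ℕ.^ k)))

ℕ→ℚ-mono-≤ : ∀ {a b} → a ℕ.≤ b → ℕ→ℚ a ≤ ℕ→ℚ b
ℕ→ℚ-mono-≤ {a} {b} a≤b = ℚₚ.toℚᵘ-cancel-≤
  (subst₂ ℚᵘ._≤_ (sym (ℕ→ℚ-toℚᵘ a)) (sym (ℕ→ℚ-toℚᵘ b))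
    (ℚᵘ.*≤* (ℤₚ.*-monoʳ-≤-nonNeg (+ 1) (ℤ.+≤+ a≤b))))

ℕ→ℚ-suc-1 : ∀ n → ℕ→ℚ (suc n) - 1ℚ ≡ ℕ→ℚ n
ℕ→ℚ-suc-1 n = trans (cong (_- 1ℚ) (ℕ→ℚ-homo-+ 1 n)) (solve 1 (λ x → (con 1ℚ :+ x) :- con 1ℚ := x) refl (ℕ→ℚ n))

ℕ→ℚ-sub-suc : ∀ n l → ℕ→ℚ n - ℕ→ℚ (suc l) ≡ (ℕ→ℚ n - ℕ→ℚ l) - 1ℚ
ℕ→ℚ-sub-suc n l = trans (cong (ℕ→ℚ n -_) (ℕ→ℚ-homo-+ 1 l))
  (solve 2 (λ a b → a :- (con 1ℚ :+ b) := (a :- b) :- con 1ℚ) refl (ℕ→ℚ n) (ℕ→ℚ l))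

ℕ→ℚ-positive : ∀ {D} → 0 ℕ.< D → ℚ.Positive (ℕ→ℚ D)
ℕ→ℚ-positive 0<D = ℚ.positive (ℚₚ.<-≤-trans (ℚₚ.positive⁻¹ 1ℚ) (ℕ→ℚ-mono-≤ 0<D))


IsIndicatorOf : Set → ℚ → Set
IsIndicatorOf P x = (P → x ≡ 1ℚ) × (¬ P → x ≡ 0ℚ)

𝟙-isIndicatorOf : ∀ {P : Set} (d : Dec P) → IsIndicatorOf P (𝟙 d)
𝟙-isIndicatorOf (yes p) = (λ _ → refl) , (λ ¬p → ⊥-elim (¬p p))
𝟙-isIndicatorOf (no ¬p) = (λ p → ⊥-elim (¬p p)) , (λ _ → refl)

𝟙-unique : ∀ {P : Set} {x} → IsIndicatorOf P x → (d : Dec P) → 𝟙 d ≡ x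
𝟙-unique (is1 , _) (yes p) = sym (is1 p)
𝟙-unique (_ , is0) (no ¬p) = sym (is0 ¬p)

isIndicatorOf-⇔ : ∀ {P Q : Set} {x} → (P → Q) → (Q → P) → IsIndicatorOf P x → IsIndicatorOf Q x
isIndicatorOf-⇔ to from (is1 , is0) = (λ q → is1 (from q)) , (λ ¬q → is0 (λ p → ¬q (to p)))

𝟙-*-isIndicatorOf : ∀ {P Q : Set} {y} (d : Dec P) → IsIndicatorOf Q y → IsIndicatorOf (P × Q) (𝟙 d * y)
𝟙-*-isIndicatorOf {y = y} (yes p) (is1 , is0) =
  (λ (_ , q) → cong (1ℚ *_) (is1 q)) , (λ ¬pq → cong (1ℚ *_) (is0 (λ q → ¬pq (p , q))))
𝟙-*-isIndicatorOf {y = y} (no ¬p) _ =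
  (λ (p , _) → ⊥-elim (¬p p)) , (λ _ → ℚₚ.*-zeroˡ y)

𝟙-*-cong : ∀ {P : Set} (d : Dec P) {x y} → (P → x ≡ y) → 𝟙 d * x ≡ 𝟙 d * y
𝟙-*-cong (yes p)         eq = cong (1ℚ *_) (eq p)
𝟙-*-cong (no _)  {x} {y} _  = trans (ℚₚ.*-zeroˡ x) (sym (ℚₚ.*-zeroˡ y))

𝟙-*-vanishes : ∀ {P : Set} (d : Dec P) {x} → (P → x ≡ 0ℚ) → 𝟙 d * x ≡ 0ℚ
𝟙-*-vanishes d eq = trans (𝟙-*-cong d eq) (ℚₚ.*-zeroʳ (𝟙 d))

𝟙-cong : ∀ {P Q : Set} → (P → Q) → (Q → P) → (d : Dec P) (e : Dec Q) → 𝟙 d ≡ 𝟙 e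
𝟙-cong to from d e = 𝟙-unique (isIndicatorOf-⇔ from to (𝟙-isIndicatorOf e)) d


ΣFin-cong : ∀ k {f g : Fin k → ℚ} → (∀ t → f t ≡ g t) → ΣFin k f ≡ ΣFin k g
ΣFin-cong zero    eq = refl
ΣFin-cong (suc k) eq = cong₂ _+_ (eq zero) (ΣFin-cong k (λ t → eq (suc t)))

ΣFin-zero : ∀ k {f : Fin k → ℚ} → (∀ t → f t ≡ 0ℚ) → ΣFin k f ≡ 0ℚ
ΣFin-zero zero    eq = refl
ΣFin-zero (suc k) eq = cong₂ _+_ (eq zero) (ΣFin-zero k (λ t → eq (suc t)))

ΣFin-scale : ∀ k c (f : Fin k → ℚ) → ΣFin k (λ t → c * f t) ≡ c * ΣFin k f
ΣFin-scale zero    c f = sym (ℚₚ.*-zeroʳ c)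
ΣFin-scale (suc k) c f =
  trans (cong (λ z → c * f zero + z) (ΣFin-scale k c _)) (sym (ℚₚ.*-distribˡ-+ c _ _))

ΣFin-- : ∀ k (f g : Fin k → ℚ) → ΣFin k (λ t → f t - g t) ≡ ΣFin k f - ΣFin k g
ΣFin-- zero    f g = refl
ΣFin-- (suc k) f g = trans (cong (λ z → (f zero - g zero) + z) (ΣFin-- k _ _))
  (solve 4 (λ a b c d → (a :- b) :+ (c :- d) := (a :+ c) :- (b :+ d)) refl (f zero) (g zero) _ _)

ΣFin-1 : ∀ k → ΣFin k (λ _ → 1ℚ) ≡ ℕ→ℚ k
ΣFin-1 zero    = refl
ΣFin-1 (suc k) = trans (cong (λ z → 1ℚ + z) (ΣFin-1 k)) (sym (ℕ→ℚ-homo-+ 1 k))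

ΣFin-𝟙≟ : ∀ k (y : Fin k) → ΣFin k (λ x → 𝟙 (y ≟ x)) ≡ 1ℚ
ΣFin-𝟙≟ (suc k) zero    = cong (λ z → 1ℚ + z) (ΣFin-zero k (λ _ → refl))
ΣFin-𝟙≟ (suc k) (suc y) = trans (cong (λ z → 0ℚ + z) (trans (ΣFin-cong k 𝟙-suc≟suc) (ΣFin-𝟙≟ k y)))
                                 (ℚₚ.+-identityˡ 1ℚ)
  where
  𝟙-suc≟suc : ∀ x → 𝟙 (suc y ≟ suc x) ≡ 𝟙 (y ≟ x)
  𝟙-suc≟suc x = 𝟙-cong Finₚ.suc-injective (cong suc) (suc y ≟ suc x) (y ≟ x)

ΣFun-cong : ∀ k n {f g : (Fin k → Fin n) → ℚ} → (∀ u → f u ≡ g u) → ΣFun k n f ≡ ΣFun k n g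
ΣFun-cong zero    n eq = eq _
ΣFun-cong (suc k) n eq = ΣFin-cong n (λ x → ΣFun-cong k n (λ u → eq (cons x u)))

ΣFun-zero : ∀ k n {f : (Fin k → Fin n) → ℚ} → (∀ u → f u ≡ 0ℚ) → ΣFun k n f ≡ 0ℚ
ΣFun-zero zero    n eq = eq _
ΣFun-zero (suc k) n eq = ΣFin-zero n (λ x → ΣFun-zero k n (λ u → eq (cons x u)))

ΣFun-scale : ∀ k n c (f : (Fin k → Fin n) → ℚ) → ΣFun k n (λ u → c * f u) ≡ c * ΣFun k n f
ΣFun-scale zero    n c f = refl
ΣFun-scale (suc k) n c f = trans (ΣFin-cong n (λ x → ΣFun-scale k n c _)) (ΣFin-scale n c _)

ΣFun-scaleʳ : ∀ k n c (f : (Fin k → Fin n) → ℚ) → ΣFun k n (λ u → f u * c) ≡ ΣFun k n f * c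
ΣFun-scaleʳ k n c f = begin
  ΣFun k n (λ u → f u * c)  ≡⟨ ΣFun-cong k n (λ u → ℚₚ.*-comm (f u) c) ⟩
  ΣFun k n (λ u → c * f u)  ≡⟨ ΣFun-scale k n c f ⟩
  c * ΣFun k n f            ≡⟨ ℚₚ.*-comm c _ ⟩
  ΣFun k n f * c            ∎
  where open ≡-Reasoning

ΣFun-*-ΣFun : ∀ k n (f g : (Fin k → Fin n) → ℚ) →
  ΣFun k n f * ΣFun k n g ≡ ΣFun k n (λ u → ΣFun k n (λ v → f u * g v))
ΣFun-*-ΣFun k n f g = trans (sym (ΣFun-scaleʳ k n _ f)) (ΣFun-cong k n (λ u → sym (ΣFun-scale k n (f u) g)))

ΠFin-𝟙≟-isIndicatorOf : ∀ {n} k (u v : Fin k → Fin n) →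
  IsIndicatorOf (∀ t → u t ≡ v t) (ΠFin k (λ t → 𝟙 (u t ≟ v t)))
ΠFin-𝟙≟-isIndicatorOf zero    u v = (λ _ → refl) , (λ ≢ → ⊥-elim (≢ (λ ())))
ΠFin-𝟙≟-isIndicatorOf (suc k) u v = isIndicatorOf-⇔
  (λ (eq₀ , eq′) → λ { zero → eq₀ ; (suc t) → eq′ t }) (λ eq → eq zero , (λ t → eq (suc t)))
  (𝟙-*-isIndicatorOf (u zero ≟ v zero) (ΠFin-𝟙≟-isIndicatorOf k (λ t → u (suc t)) (λ t → v (suc t))))

ΣFun-ΠFin-𝟙≟ : ∀ k n (u : Fin k → Fin n) → ΣFun k n (λ v → ΠFin k (λ t → 𝟙 (u t ≟ v t))) ≡ 1ℚ
ΣFun-ΠFin-𝟙≟ zero    n u = refl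
ΣFun-ΠFin-𝟙≟ (suc k) n u = begin
  ΣFin n (λ x → ΣFun k n (λ v → 𝟙 (u zero ≟ x) * ΠFin k (λ t → 𝟙 (u (suc t) ≟ v t))))
    ≡⟨ ΣFin-cong n (λ x → ΣFun-scale k n (𝟙 (u zero ≟ x)) _) ⟩
  ΣFin n (λ x → 𝟙 (u zero ≟ x) * ΣFun k n (λ v → ΠFin k (λ t → 𝟙 (u (suc t) ≟ v t))))
    ≡⟨ ΣFin-cong n (λ x → cong (𝟙 (u zero ≟ x) *_) (ΣFun-ΠFin-𝟙≟ k n (λ t → u (suc t)))) ⟩
  ΣFin n (λ x → 𝟙 (u zero ≟ x) * 1ℚ)
    ≡⟨ ΣFin-cong n (λ x → ℚₚ.*-identityʳ (𝟙 (u zero ≟ x))) ⟩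
  ΣFin n (λ x → 𝟙 (u zero ≟ x))
    ≡⟨ ΣFin-𝟙≟ n (u zero) ⟩
  1ℚ ∎
  where open ≡-Reasoning


-- Linear expectation functionals and independence

record Linear {X : Set} (E : (X → ℚ) → ℚ) : Set where
  field
    E-cong  : ∀ {f g} → (∀ x → f x ≡ g x) → E f ≡ E g
    E-+     : ∀ f g → E (λ x → f x + g x) ≡ E f + E g
    E-scale : ∀ c f → E (λ x → c * f x) ≡ c * E f
    E-const : ∀ c → E (λ _ → c) ≡ c
open Linear

Linear-nested : ∀ {A B X : Set} {E : (A → ℚ) → ℚ} {E′ : (B → ℚ) → ℚ} → Linear E → Linear E′ →
  (h : A → B → X) → Linear (λ f → E (λ a → E′ (λ b → f (h a b))))
Linear-nested L L′ h = record
  { E-cong  = λ eq → E-cong L (λ a → E-cong L′ (λ b → eq (h a b)))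
  ; E-+     = λ f g → trans (E-cong L (λ a → E-+ L′ (λ b → f (h a b)) (λ b → g (h a b)))) (E-+ L _ _)
  ; E-scale = λ c f → trans (E-cong L (λ a → E-scale L′ c (λ b → f (h a b)))) (E-scale L c _)
  ; E-const = λ c → trans (E-cong L (λ a → E-const L′ c)) (E-const L c)
  }

module _ {X : Set} {E : (X → ℚ) → ℚ} (L : Linear E) where

  E-ΣFin : ∀ k (f : Fin k → X → ℚ) → E (λ x → ΣFin k (λ t → f t x)) ≡ ΣFin k (λ t → E (f t))
  E-ΣFin zero    f = E-const L 0ℚ
  E-ΣFin (suc k) f = trans (E-+ L _ _) (cong (λ z → E (f zero) + z) (E-ΣFin k (λ t → f (suc t))))

  E-ΣFun : ∀ k n (f : (Fin k → Fin n) → X → ℚ) →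
    E (λ x → ΣFun k n (λ u → f u x)) ≡ ΣFun k n (λ u → E (f u))
  E-ΣFun zero    n f = E-cong L (λ _ → refl)
  E-ΣFun (suc k) n f = trans (E-ΣFin n _) (ΣFin-cong n (λ y → E-ΣFun k n (λ u → f (cons y u))))

IsProbability : Dist → Set
IsProbability d = E₀ d (λ _ → 1ℚ) ≡ 1ℚ

E₀-cong : ∀ d {f g} → (∀ o → f o ≡ g o) → E₀ d f ≡ E₀ d g
E₀-cong []            eq = refl
E₀-cong ((o , p) ∷ d) eq = cong₂ (λ a b → p * a + b) (eq o) (E₀-cong d eq)

E₀-+ : ∀ d f g → E₀ d (λ o → f o + g o) ≡ E₀ d f + E₀ d g
E₀-+ []            f g = refl
E₀-+ ((o , p) ∷ d) f g = trans (cong (λ z → p * (f o + g o) + z) (E₀-+ d f g))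
  (solve 5 (λ p a b x y → p :* (a :+ b) :+ (x :+ y) := (p :* a :+ x) :+ (p :* b :+ y))
    refl p (f o) (g o) (E₀ d f) (E₀ d g))

E₀-scale : ∀ d c f → E₀ d (λ o → c * f o) ≡ c * E₀ d f
E₀-scale []            c f = sym (ℚₚ.*-zeroʳ c)
E₀-scale ((o , p) ∷ d) c f = trans (cong (λ z → p * (c * f o) + z) (E₀-scale d c f))
  (solve 4 (λ p c a x → p :* (c :* a) :+ c :* x := c :* (p :* a :+ x)) refl p c (f o) (E₀ d f))

E₀-const : ∀ d c → E₀ d (λ _ → c) ≡ E₀ d (λ _ → 1ℚ) * c
E₀-const []            c = sym (ℚₚ.*-zeroˡ c)
E₀-const ((o , p) ∷ d) c = trans (cong (λ z → p * c + z) (E₀-const d c))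
  (solve 3 (λ p c x → p :* c :+ x :* c := (p :* con 1ℚ :+ x) :* c) refl p c (E₀ d (λ _ → 1ℚ)))

Linear-E₀ : ∀ d → IsProbability d → Linear (E₀ d)
Linear-E₀ d prob = record
  { E-cong = E₀-cong d ; E-+ = E₀-+ d ; E-scale = E₀-scale d
  ; E-const = λ c → trans (E₀-const d c) (trans (cong (_* c) prob) (ℚₚ.*-identityˡ c)) }

Linear-E₁ : ∀ b μ → (∀ i → IsProbability (μ i)) → Linear (E₁ b μ)
Linear-E₁ zero    μ prob = record
  { E-cong = λ eq → eq _ ; E-+ = λ _ _ → refl ; E-scale = λ _ _ → refl ; E-const = λ _ → refl }
Linear-E₁ (suc b) μ prob =
  Linear-nested (Linear-E₀ (μ zero) (prob zero)) (Linear-E₁ b (λ i → μ (suc i)) (λ i → prob (suc i))) cons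

Linear-E₂ : ∀ a b μ → (∀ i j → IsProbability (μ i j)) → Linear (E₂ a b μ)
Linear-E₂ zero    b μ prob = record
  { E-cong = λ eq → eq _ ; E-+ = λ _ _ → refl ; E-scale = λ _ _ → refl ; E-const = λ _ → refl }
Linear-E₂ (suc a) b μ prob =
  Linear-nested (Linear-E₁ b (μ zero) (prob zero)) (Linear-E₂ a b (λ i → μ (suc i)) (λ i → prob (suc i))) cons

AgreeExcept₁ : ∀ {b} → Fin b → (g g′ : Fin b → Out) → Set
AgreeExcept₁ c g g′ = ∀ c′ → c′ ≢ c → g c′ ≡ g′ c′

AgreeExcept₂ : ∀ {a b} → Fin a → Fin b → (G G′ : Fin a → Fin b → Out) → Set
AgreeExcept₂ r c G G′ = ∀ r′ c′ → ¬ (r′ ≡ r × c′ ≡ c) → G r′ c′ ≡ G′ r′ c′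

E₁-factor : ∀ b μ → (∀ i → IsProbability (μ i)) → ∀ c h R →
  (∀ g g′ → AgreeExcept₁ c g g′ → R g ≡ R g′) →
  E₁ b μ (λ g → h (g c) * R g) ≡ E₀ (μ c) h * E₁ b μ R
E₁-factor (suc b) μ prob zero h R ignores = begin
  E₀ (μ zero) (λ o → E₁ b μ′ (λ g → h o * R (cons o g)))  ≡⟨ E₀-cong (μ zero) (λ o → E-scale L′ (h o) _) ⟩
  E₀ (μ zero) (λ o → h o * K o)                            ≡⟨ E₀-cong (μ zero) (λ o → cong (h o *_) (K-const o)) ⟩
  E₀ (μ zero) (λ o → h o * K₀)                             ≡⟨ E₀-cong (μ zero) (λ o → ℚₚ.*-comm (h o) K₀) ⟩
  E₀ (μ zero) (λ o → K₀ * h o)                             ≡⟨ E₀-scale (μ zero) K₀ h ⟩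
  K₀ * E₀ (μ zero) h                                       ≡⟨ ℚₚ.*-comm K₀ _ ⟩
  E₀ (μ zero) h * K₀                                       ≡⟨ cong (E₀ (μ zero) h *_) E₀-K ⟨
  E₀ (μ zero) h * E₀ (μ zero) K                            ∎
  where
  open ≡-Reasoning
  μ′ : Fin b → Dist
  μ′ i = μ (suc i)
  L′ : Linear (E₁ b μ′)
  L′ = Linear-E₁ b μ′ (λ i → prob (suc i))
  K : Out → ℚ
  K o = E₁ b μ′ (λ g → R (cons o g))
  K₀ : ℚ
  K₀ = K (Bool.false , Bool.false)
  K-const : ∀ o → K o ≡ K₀
  K-const o = E-cong L′ (λ g → ignores _ _ λ { zero 0≢0 → ⊥-elim (0≢0 refl) ; (suc c′) _ → refl })
  E₀-K : E₀ (μ zero) K ≡ K₀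
  E₀-K = trans (E₀-cong (μ zero) K-const) (E-const (Linear-E₀ (μ zero) (prob zero)) K₀)
E₁-factor (suc b) μ prob (suc c) h R ignores = begin
  E₀ (μ zero) (λ o → E₁ b μ′ (λ g → h (g c) * R (cons o g)))
    ≡⟨ E₀-cong (μ zero) (λ o → E₁-factor b μ′ (λ i → prob (suc i)) c h (λ g → R (cons o g))
         (λ g g′ eq → ignores _ _ λ { zero _ → refl ; (suc c′) c′≢c → eq c′ (λ e → c′≢c (cong suc e)) })) ⟩
  E₀ (μ zero) (λ o → E₀ (μ′ c) h * E₁ b μ′ (λ g → R (cons o g)))
    ≡⟨ E₀-scale (μ zero) (E₀ (μ′ c) h) _ ⟩
  E₀ (μ′ c) h * E₀ (μ zero) (λ o → E₁ b μ′ (λ g → R (cons o g)))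
    ∎
  where
  open ≡-Reasoning
  μ′ : Fin b → Dist
  μ′ i = μ (suc i)

E₂-factor : ∀ a b μ → (∀ i j → IsProbability (μ i j)) → ∀ r c h R →
  (∀ G G′ → AgreeExcept₂ r c G G′ → R G ≡ R G′) →
  E₂ a b μ (λ G → h (G r c) * R G) ≡ E₀ (μ r c) h * E₂ a b μ R
E₂-factor (suc a) b μ prob zero c h R ignores = begin
  E₁ b (μ zero) (λ row → E₂ a b μ′ (λ rest → h (row c) * R (cons row rest)))
    ≡⟨ E-cong L₁ (λ row → E-scale L′ (h (row c)) _) ⟩
  E₁ b (μ zero) (λ row → h (row c) * K row)
    ≡⟨ E₁-factor b (μ zero) (prob zero) c h K (λ g g′ eq → E-cong L′ (λ rest → ignores _ _
         λ { zero c′ ¬eq → eq c′ (λ e → ¬eq (refl , e)) ; (suc r′) c′ _ → refl })) ⟩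
  E₀ (μ zero c) h * E₁ b (μ zero) K
    ∎
  where
  open ≡-Reasoning
  μ′ : Fin a → Fin b → Dist
  μ′ i = μ (suc i)
  L′ : Linear (E₂ a b μ′)
  L′ = Linear-E₂ a b μ′ (λ i → prob (suc i))
  L₁ : Linear (E₁ b (μ zero))
  L₁ = Linear-E₁ b (μ zero) (prob zero)
  K : (Fin b → Out) → ℚ
  K row = E₂ a b μ′ (λ rest → R (cons row rest))
E₂-factor (suc a) b μ prob (suc r) c h R ignores = begin
  E₁ b (μ zero) (λ row → E₂ a b μ′ (λ rest → h (rest r c) * R (cons row rest)))
    ≡⟨ E-cong L₁ (λ row → E₂-factor a b μ′ (λ i → prob (suc i)) r c h (λ rest → R (cons row rest))
         (λ G G′ eq → ignores _ _ λ { zero c′ _ → refl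
                                    ; (suc r′) c′ ¬eq → eq r′ c′ (λ (e₁ , e₂) → ¬eq (cong suc e₁ , e₂)) })) ⟩
  E₁ b (μ zero) (λ row → E₀ (μ′ r c) h * E₂ a b μ′ (λ rest → R (cons row rest)))
    ≡⟨ E-scale L₁ (E₀ (μ′ r c) h) _ ⟩
  E₀ (μ′ r c) h * E₁ b (μ zero) (λ row → E₂ a b μ′ (λ rest → R (cons row rest)))
    ∎
  where
  open ≡-Reasoning
  μ′ : Fin a → Fin b → Dist
  μ′ i = μ (suc i)
  L₁ : Linear (E₁ b (μ zero))
  L₁ = Linear-E₁ b (μ zero) (prob zero)


-- Counting subsets and injections

-- Taken in ℚ so that the number n − |L| of values outside a list L needs no truncated subtraction.
fallingℚ : ℚ → ℕ → ℚ
fallingℚ x zero    = 1ℚ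
fallingℚ x (suc k) = x * fallingℚ (x - 1ℚ) k

fallingℚ-ℕ→ℚ : ∀ N k → fallingℚ (ℕ→ℚ N) k ≡ ℕ→ℚ (N P′ k)
fallingℚ-ℕ→ℚ N       zero    = refl
fallingℚ-ℕ→ℚ zero    (suc k) =
  trans (ℚₚ.*-zeroˡ (fallingℚ (0ℚ - 1ℚ) k)) (cong (λ z → ℕ→ℚ (z ℕ.* (0 P′ k))) (sym (ℕₚ.0∸n≡0 k)))
fallingℚ-ℕ→ℚ (suc N) (suc k) = begin
  ℕ→ℚ (suc N) * fallingℚ (ℕ→ℚ (suc N) - 1ℚ) k  ≡⟨ cong (λ x → ℕ→ℚ (suc N) * fallingℚ x k) (ℕ→ℚ-suc-1 N) ⟩
  ℕ→ℚ (suc N) * fallingℚ (ℕ→ℚ N) k             ≡⟨ cong (ℕ→ℚ (suc N) *_) (fallingℚ-ℕ→ℚ N k) ⟩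
  ℕ→ℚ (suc N) * ℕ→ℚ (N P′ k)                   ≡⟨ ℕ→ℚ-homo-* (suc N) (N P′ k) ⟨
  ℕ→ℚ (suc N ℕ.* (N P′ k))                     ≡⟨ cong ℕ→ℚ (nP′k≡n[n∸1P′k∸1] (suc N) (suc k)) ⟨
  ℕ→ℚ (suc N P′ suc k)                         ∎
  where open ≡-Reasoning

P′-vanishes : ∀ {n k} → n ℕ.< k → n P′ k ≡ 0
P′-vanishes {n} {suc k} (ℕ.s≤s n≤k) with ℕₚ.m≤n⇒m<n∨m≡n n≤k
... | inj₁ n<k  = trans (cong ((n ∸ k) ℕ.*_) (P′-vanishes n<k)) (ℕₚ.*-zeroʳ (n ∸ k))
... | inj₂ refl = cong (ℕ._* (n P′ n)) (ℕₚ.n∸n≡0 n)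

C*!≡P′ : ∀ n k → (n C k) ℕ.* k ! ≡ n P′ k
C*!≡P′ n k with ℕₚ.≤-<-connex k n
... | inj₁ k≤n = begin
  (n C k) ℕ.* k !                        ≡⟨ cong (ℕ._* k !) (nCk≡nPk/k! k≤n) ⟩
  ((n Combinatorics.P k) ℕ./ k !) ℕ.* k ! ≡⟨ cong (λ z → (z ℕ./ k !) ℕ.* k !) P≡P′ ⟩
  ((n P′ k) ℕ./ k !) ℕ.* k !             ≡⟨ m/n*n≡m (k!∣nP′k k≤n) ⟩
  n P′ k                                 ∎
  where
  open ≡-Reasoning
  instance
    k!≢0 : NonZero (k !)
    k!≢0 = k ℕₚ.!≢0
  P≡P′ : n Combinatorics.P k ≡ n P′ k
  P≡P′ = trans (nPk≡n!/[n∸k]! k≤n) (sym (nP′k≡n!/[n∸k]! k≤n))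
... | inj₂ n<k = trans (cong (ℕ._* k !) (k>n⇒nCk≡0 n<k)) (sym (P′-vanishes n<k))

≤-2*∸ : ∀ {M} s → 2 ℕ.* s ℕ.≤ M → M ℕ.≤ 2 ℕ.* (M ∸ s)
≤-2*∸ {M} s 2s≤M = subst (M ℕ.≤_) (sym (ℕₚ.*-distribˡ-∸ 2 M s)) (ℕₚ.m+n≤o⇒m≤o∸n M M+2s≤2M)
  where
  M+2s≤2M : M ℕ.+ 2 ℕ.* s ℕ.≤ 2 ℕ.* M
  M+2s≤2M = subst (M ℕ.+ 2 ℕ.* s ℕ.≤_) (cong (M ℕ.+_) (sym (ℕₚ.+-identityʳ M))) (ℕₚ.+-monoʳ-≤ M 2s≤M)

^≤2^*P′ : ∀ M a k → (∀ t → t ℕ.< k → M ℕ.≤ 2 ℕ.* (a ∸ t)) → M ℕ.^ k ℕ.≤ 2 ℕ.^ k ℕ.* (a P′ k)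
^≤2^*P′ M a zero    _     = ℕₚ.≤-refl
^≤2^*P′ M a (suc k) large = ℕₚ.≤-trans
  (ℕₚ.*-mono-≤ (large k (ℕₚ.n<1+n k)) (^≤2^*P′ M a k (λ t t<k → large t (ℕₚ.m<n⇒m<1+n t<k))))
  (ℕₚ.≤-reflexive (regroup 2 (a ∸ k) (2 ℕ.^ k) (a P′ k)))
  where
  regroup : ∀ w x y z → (w ℕ.* x) ℕ.* (y ℕ.* z) ≡ (w ℕ.* y) ℕ.* (x ℕ.* z)
  regroup = ℕ-Ring.solve-∀

Injective : ∀ {k n} → (Fin k → Fin n) → Set
Injective u = ∀ s t → u s ≡ u t → s ≡ t

Injective-tail : ∀ {k n} {u : Fin (suc k) → Fin n} → Injective u → Injective (λ t → u (suc t))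
Injective-tail inj s t eq = Finₚ.suc-injective (inj (suc s) (suc t) eq)

Injective-head : ∀ {k n} {u : Fin (suc k) → Fin n} → Injective u → ∀ t → u (suc t) ≢ u zero
Injective-head inj t eq with inj (suc t) zero eq
... | ()

TreeChoice-tail : ∀ {k n} {i : Fin n} {u : Fin (suc k) → Fin n} → TreeChoice i u → TreeChoice i (λ t → u (suc t))
TreeChoice-tail (inj , avoids) = Injective-tail inj , (λ t → avoids (suc t))

TreeChoice-≗ : ∀ {k n} {i : Fin n} {u v : Fin k → Fin n} → (∀ t → u t ≡ v t) → TreeChoice i u → TreeChoice i v
TreeChoice-≗ u≗v (inj , avoids) =
  (λ s t eq → inj s t (trans (u≗v s) (trans eq (sym (u≗v t))))) , (λ t eq → avoids t (trans (u≗v t) eq))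

Increasing⇒Injective : ∀ {k m} {α : Fin k → Fin m} → Increasing α → Injective α
Increasing⇒Injective {α = α} inc s t eq with Finₚ.<-cmp s t
... | tri< s<t _ _ = ⊥-elim (Finₚ.<-irrefl eq (inc s t s<t))
... | tri≈ _ s≡t _ = s≡t
... | tri> _ _ t<s = ⊥-elim (Finₚ.<-irrefl (sym eq) (inc t s t<s))

AllAbove : ∀ {k m} → ℕ → (Fin k → Fin m) → Set
AllAbove b α = ∀ t → b ℕ.≤ toℕ (α t)

-- The indicator of (Increasing α × AllAbove b α) in a product form that ΣFun sums one coordinate at a time.
increasingAbove : ∀ {m} k → ℕ → (Fin k → Fin m) → ℚ
increasingAbove zero    b α = 1ℚ
increasingAbove (suc k) b α =
  𝟙 (b ℕ.≤? toℕ (α zero)) * increasingAbove k (suc (toℕ (α zero))) (λ t → α (suc t))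

increasingAbove-isIndicatorOf : ∀ {m} k b (α : Fin k → Fin m) →
  IsIndicatorOf (Increasing α × AllAbove b α) (increasingAbove k b α)
increasingAbove-isIndicatorOf zero    b α = (λ _ → refl) , (λ none → ⊥-elim (none ((λ ()) , (λ ()))))
increasingAbove-isIndicatorOf {m} (suc k) b α = isIndicatorOf-⇔ join split
  (𝟙-*-isIndicatorOf (b ℕ.≤? toℕ (α zero)) (increasingAbove-isIndicatorOf k (suc (toℕ (α zero))) α′))
  where
  α′ : Fin k → Fin m
  α′ t = α (suc t)
  join : b ℕ.≤ toℕ (α zero) × (Increasing α′ × AllAbove (suc (toℕ (α zero))) α′) → Increasing α × AllAbove b α
  join (b≤α₀ , inc′ , above′) = inc , above
    where
    inc : Increasing α
    inc zero    (suc t) _   = above′ t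
    inc (suc s) (suc t) s<t = inc′ s t (ℕ.s≤s⁻¹ s<t)
    above : AllAbove b α
    above zero    = b≤α₀
    above (suc t) = ℕₚ.≤-trans b≤α₀ (ℕₚ.<⇒≤ (above′ t))
  split : Increasing α × AllAbove b α → b ℕ.≤ toℕ (α zero) × (Increasing α′ × AllAbove (suc (toℕ (α zero))) α′)
  split (inc , above) = above zero , (λ s t s<t → inc (suc s) (suc t) (ℕ.s≤s s<t)) , (λ t → inc zero (suc t) ℕ.z<s)

ΣFin-hockey-stick : ∀ M b k →
  ΣFin M (λ x → 𝟙 (b ℕ.≤? toℕ x) * ℕ→ℚ ((M ∸ suc (toℕ x)) C k)) ≡ ℕ→ℚ ((M ∸ b) C suc k)
ΣFin-hockey-stick zero    b       k = cong (λ z → ℕ→ℚ (z C suc k)) (sym (ℕₚ.0∸n≡0 b))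
ΣFin-hockey-stick (suc M) zero    k = begin
  1ℚ * ℕ→ℚ (M C k) + ΣFin M (λ x → 𝟙 (0 ℕ.≤? toℕ x) * ℕ→ℚ ((M ∸ suc (toℕ x)) C k))
                                         ≡⟨ cong₂ _+_ (ℚₚ.*-identityˡ (ℕ→ℚ (M C k))) (ΣFin-hockey-stick M 0 k) ⟩
  ℕ→ℚ (M C k) + ℕ→ℚ (M C suc k)          ≡⟨ ℕ→ℚ-homo-+ (M C k) (M C suc k) ⟨
  ℕ→ℚ (M C k ℕ.+ M C suc k)              ≡⟨ cong ℕ→ℚ (nCk+nC[k+1]≡[n+1]C[k+1] M k) ⟩
  ℕ→ℚ (suc M C suc k)                    ∎
  where open ≡-Reasoning
ΣFin-hockey-stick (suc M) (suc b) k = begin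
  0ℚ * ℕ→ℚ (M C k) + ΣFin M (λ x → 𝟙 (suc b ℕ.≤? suc (toℕ x)) * ℕ→ℚ ((M ∸ suc (toℕ x)) C k))
                                         ≡⟨ cong₂ _+_ (ℚₚ.*-zeroˡ (ℕ→ℚ (M C k)))
                                                      (trans (ΣFin-cong M shift) (ΣFin-hockey-stick M b k)) ⟩
  0ℚ + ℕ→ℚ ((M ∸ b) C suc k)             ≡⟨ ℚₚ.+-identityˡ (ℕ→ℚ ((M ∸ b) C suc k)) ⟩
  ℕ→ℚ ((M ∸ b) C suc k)                  ∎
  where
  open ≡-Reasoning
  shift : ∀ x → 𝟙 (suc b ℕ.≤? suc (toℕ x)) * ℕ→ℚ ((M ∸ suc (toℕ x)) C k)
              ≡ 𝟙 (b ℕ.≤? toℕ x) * ℕ→ℚ ((M ∸ suc (toℕ x)) C k)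
  shift x = cong (_* _) (𝟙-cong ℕ.s≤s⁻¹ ℕ.s≤s (suc b ℕ.≤? suc (toℕ x)) (b ℕ.≤? toℕ x))

ΣFun-increasingAbove : ∀ m k b → ΣFun k m (increasingAbove k b) ≡ ℕ→ℚ ((m ∸ b) C k)
ΣFun-increasingAbove m zero    b = refl
ΣFun-increasingAbove m (suc k) b = begin
  ΣFin m (λ x → ΣFun k m (λ g → 𝟙 (b ℕ.≤? toℕ x) * increasingAbove k (suc (toℕ x)) g))
    ≡⟨ ΣFin-cong m (λ x → ΣFun-scale k m (𝟙 (b ℕ.≤? toℕ x)) _) ⟩
  ΣFin m (λ x → 𝟙 (b ℕ.≤? toℕ x) * ΣFun k m (increasingAbove k (suc (toℕ x))))
    ≡⟨ ΣFin-cong m (λ x → cong (𝟙 (b ℕ.≤? toℕ x) *_) (ΣFun-increasingAbove m k (suc (toℕ x)))) ⟩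
  ΣFin m (λ x → 𝟙 (b ℕ.≤? toℕ x) * ℕ→ℚ ((m ∸ suc (toℕ x)) C k))
    ≡⟨ ΣFin-hockey-stick m b k ⟩
  ℕ→ℚ ((m ∸ b) C suc k)
    ∎
  where open ≡-Reasoning

ΣFun-increasing : ∀ m k → ΣFun k m (λ α → 𝟙 (increasing? α)) ≡ ℕ→ℚ (m C k)
ΣFun-increasing m k = trans (ΣFun-cong k m (λ α → 𝟙-unique (isIndicatorOf-⇔ proj₁ (λ inc → inc , λ _ → ℕ.z≤n)
                                                 (increasingAbove-isIndicatorOf k 0 α)) (increasing? α)))
                            (ΣFun-increasingAbove m k 0)

module _ {n : ℕ} where

  _∉?_ : (x : Fin n) (L : List (Fin n)) → Dec (x ∉ L)
  x ∉? L = ¬? (any? (x ≟_) L)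

  𝟙∉?-∷ : ∀ x y L → y ∉ L → 𝟙 (x ∉? (y ∷ L)) ≡ 𝟙 (x ∉? L) - 𝟙 (y ≟ x)
  𝟙∉?-∷ x y L y∉L with y ≟ x
  ... | yes refl = trans (proj₂ (𝟙-isIndicatorOf (x ∉? (x ∷ L))) (λ x∉xL → x∉xL (here refl)))
                         (cong (_- 1ℚ) (sym (proj₁ (𝟙-isIndicatorOf (x ∉? L)) y∉L)))
  ... | no  y≢x  = trans (𝟙-cong (λ x∉yL x∈L → x∉yL (there x∈L)) (∉-∷ y≢x) (x ∉? (y ∷ L)) (x ∉? L))
                         (sym (ℚₚ.+-identityʳ _))
    where
    ∉-∷ : y ≢ x → x ∉ L → x ∉ y ∷ L
    ∉-∷ y≢x x∉L (here x≡y) = y≢x (sym x≡y)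
    ∉-∷ y≢x x∉L (there x∈L) = x∉L x∈L

  ΣFin-∉ : ∀ L → Unique L → ΣFin n (λ x → 𝟙 (x ∉? L)) ≡ ℕ→ℚ n - ℕ→ℚ (length L)
  ΣFin-∉ []      _                = trans (ΣFin-1 n) (sym (ℚₚ.+-identityʳ (ℕ→ℚ n)))
  ΣFin-∉ (y ∷ L) (y∉L ∷ unique) = begin
    ΣFin n (λ x → 𝟙 (x ∉? (y ∷ L)))
      ≡⟨ ΣFin-cong n (λ x → 𝟙∉?-∷ x y L (All¬⇒¬Any y∉L)) ⟩
    ΣFin n (λ x → 𝟙 (x ∉? L) - 𝟙 (y ≟ x))
      ≡⟨ ΣFin-- n _ _ ⟩
    ΣFin n (λ x → 𝟙 (x ∉? L)) - ΣFin n (λ x → 𝟙 (y ≟ x))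
      ≡⟨ cong₂ _-_ (ΣFin-∉ L unique) (ΣFin-𝟙≟ n y) ⟩
    (ℕ→ℚ n - ℕ→ℚ (length L)) - 1ℚ
      ≡⟨ ℕ→ℚ-sub-suc n (length L) ⟨
    ℕ→ℚ n - ℕ→ℚ (length (y ∷ L))
      ∎
    where open ≡-Reasoning

  freshInjection : ∀ k → List (Fin n) → (Fin k → Fin n) → ℚ
  freshInjection zero    L u = 1ℚ
  freshInjection (suc k) L u = 𝟙 (u zero ∉? L) * freshInjection k (u zero ∷ L) (λ t → u (suc t))

  freshInjection-isIndicatorOf : ∀ k L (u : Fin k → Fin n) →
    IsIndicatorOf (Injective u × (∀ t → u t ∉ L)) (freshInjection k L u)
  freshInjection-isIndicatorOf zero    L u = (λ _ → refl) , (λ none → ⊥-elim (none ((λ ()) , (λ ()))))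
  freshInjection-isIndicatorOf (suc k) L u = isIndicatorOf-⇔ join split
    (𝟙-*-isIndicatorOf (u zero ∉? L) (freshInjection-isIndicatorOf k (u zero ∷ L) u′))
    where
    u′ : Fin k → Fin n
    u′ t = u (suc t)
    join : u zero ∉ L × (Injective u′ × (∀ t → u′ t ∉ u zero ∷ L)) → Injective u × (∀ t → u t ∉ L)
    join (u₀∉L , inj′ , fresh′) = inj , fresh
      where
      inj : Injective u
      inj zero    zero    _  = refl
      inj zero    (suc t) eq = ⊥-elim (fresh′ t (here (sym eq)))
      inj (suc s) zero    eq = ⊥-elim (fresh′ s (here eq))
      inj (suc s) (suc t) eq = cong suc (inj′ s t eq)
      fresh : ∀ t → u t ∉ L
      fresh zero    = u₀∉L
      fresh (suc t) = λ uₜ∈L → fresh′ t (there uₜ∈L)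
    split : Injective u × (∀ t → u t ∉ L) → u zero ∉ L × (Injective u′ × (∀ t → u′ t ∉ u zero ∷ L))
    split (inj , fresh) = fresh zero , Injective-tail inj ,
      λ { t (here eq) → Injective-head inj t eq ; t (there uₜ∈L) → fresh (suc t) uₜ∈L }

  ΣFun-freshInjection : ∀ k L → Unique L →
    ΣFun k n (freshInjection k L) ≡ fallingℚ (ℕ→ℚ n - ℕ→ℚ (length L)) k
  ΣFun-freshInjection zero    L _      = refl
  ΣFun-freshInjection (suc k) L unique = begin
    ΣFin n (λ x → ΣFun k n (λ g → 𝟙 (x ∉? L) * freshInjection k (x ∷ L) g))
      ≡⟨ ΣFin-cong n (λ x → trans (ΣFun-scale k n (𝟙 (x ∉? L)) _)
                                  (trans (𝟙-*-cong (x ∉? L) (count-after x)) (ℚₚ.*-comm _ c))) ⟩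
    ΣFin n (λ x → c * 𝟙 (x ∉? L))
      ≡⟨ ΣFin-scale n c _ ⟩
    c * ΣFin n (λ x → 𝟙 (x ∉? L))
      ≡⟨ cong (c *_) (ΣFin-∉ L unique) ⟩
    c * (ℕ→ℚ n - ℕ→ℚ (length L))
      ≡⟨ ℚₚ.*-comm c _ ⟩
    (ℕ→ℚ n - ℕ→ℚ (length L)) * fallingℚ (ℕ→ℚ n - ℕ→ℚ (suc (length L))) k
      ≡⟨ cong (λ x → (ℕ→ℚ n - ℕ→ℚ (length L)) * fallingℚ x k) (ℕ→ℚ-sub-suc n (length L)) ⟩
    fallingℚ (ℕ→ℚ n - ℕ→ℚ (length L)) (suc k)
      ∎
    where
    open ≡-Reasoning
    c : ℚ
    c = fallingℚ (ℕ→ℚ n - ℕ→ℚ (suc (length L))) k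
    count-after : ∀ x → x ∉ L → ΣFun k n (freshInjection k (x ∷ L)) ≡ c
    count-after x x∉L = ΣFun-freshInjection k (x ∷ L) (¬Any⇒All¬ L x∉L ∷ unique)

ΣFun-treeChoice : ∀ n k (i : Fin n) → ΣFun k n (λ u → 𝟙 (treeChoice? i u)) ≡ ℕ→ℚ ((n ∸ 1) P′ k)
ΣFun-treeChoice (suc n) k i = begin
  ΣFun k (suc n) (λ u → 𝟙 (treeChoice? i u))
    ≡⟨ ΣFun-cong k (suc n) (λ u → 𝟙-unique (tree≡fresh u) (treeChoice? i u)) ⟩
  ΣFun k (suc n) (freshInjection k (i ∷ []))
    ≡⟨ ΣFun-freshInjection k (i ∷ []) ([] ∷ []) ⟩
  fallingℚ (ℕ→ℚ (suc n) - 1ℚ) k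
    ≡⟨ cong (λ x → fallingℚ x k) (ℕ→ℚ-suc-1 n) ⟩
  fallingℚ (ℕ→ℚ n) k
    ≡⟨ fallingℚ-ℕ→ℚ n k ⟩
  ℕ→ℚ (n P′ k)
    ∎
  where
  open ≡-Reasoning
  tree≡fresh : ∀ u → IsIndicatorOf (TreeChoice i u) (freshInjection k (i ∷ []) u)
  tree≡fresh u = isIndicatorOf-⇔
    (λ (inj , fresh) → inj , λ t uₜ≡i → fresh t (here uₜ≡i))
    (λ (inj , avoids) → inj , λ { t (here uₜ≡i) → avoids t uₜ≡i })
    (freshInjection-isIndicatorOf k (i ∷ []) u)


-- Moments of tree products

centred : ℚ → Bool.Bool → ℚ
centred q b = b2q b - q

corrBern-isProbability : ∀ q ρ → IsProbability (corrBern q ρ)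
corrBern-isProbability = solve 2 (λ q ρ → let s = q :* (con 1ℚ :- q) in let q̄ = con 1ℚ :- q in
     (q :* q :+ ρ :* s) :* con 1ℚ :+ ((s :- ρ :* s) :* con 1ℚ :+ ((s :- ρ :* s) :* con 1ℚ
  :+ ((q̄ :* q̄ :+ ρ :* s) :* con 1ℚ :+ con 0ℚ)))
  := con 1ℚ) refl

corrBern-mean : ∀ q ρ → E₀ (corrBern q ρ) (λ o → centred q (proj₁ o)) ≡ 0ℚ
corrBern-mean = solve 2 (λ q ρ → let s = q :* (con 1ℚ :- q) in let q̄ = con 1ℚ :- q in
     (q :* q :+ ρ :* s) :* q̄ :+ ((s :- ρ :* s) :* q̄ :+ ((s :- ρ :* s) :* (con 0ℚ :- q)
  :+ ((q̄ :* q̄ :+ ρ :* s) :* (con 0ℚ :- q) :+ con 0ℚ)))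
  := con 0ℚ) refl

corrBern-covariance : ∀ q ρ →
  E₀ (corrBern q ρ) (λ o → centred q (proj₁ o) * centred q (proj₂ o)) ≡ ρ * σ² q
corrBern-covariance = solve 2 (λ q ρ → let s = q :* (con 1ℚ :- q) in let q̄ = con 1ℚ :- q in
     (q :* q :+ ρ :* s) :* (q̄ :* q̄) :+ ((s :- ρ :* s) :* (q̄ :* (con 0ℚ :- q))
  :+ ((s :- ρ :* s) :* ((con 0ℚ :- q) :* q̄) :+ ((q̄ :* q̄ :+ ρ :* s) :* ((con 0ℚ :- q) :* (con 0ℚ :- q)) :+ con 0ℚ)))
  := ρ :* s) refl

μu-isProbability : ∀ {n} q ρ (r c : Fin n) → IsProbability (μu q ρ r c)
μu-isProbability q ρ r c with r Fin.<? c
... | yes _ = corrBern-isProbability q ρ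
... | no  _ = refl

μu-< : ∀ {n} q ρ {r c : Fin n} → r Fin.< c → μu q ρ r c ≡ corrBern q ρ
μu-< q ρ {r} {c} r<c with r Fin.<? c
... | yes _   = refl
... | no  r≮c = ⊥-elim (r≮c r<c)

Linear-𝔼 : ∀ n m θ → Linear (𝔼 n m θ)
Linear-𝔼 n m θ = Linear-nested
  (Linear-E₂ n n (μu (qu θ) (ρu θ)) (μu-isProbability (qu θ) (ρu θ)))
  (Linear-E₂ n m (λ _ _ → corrBern (qa θ) (ρa θ)) (λ _ _ → corrBern-isProbability (qa θ) (ρa θ))) _,_

SamePair : ∀ {n} (x y r c : Fin n) → Set
SamePair x y r c = (x ≡ r × y ≡ c) ⊎ (x ≡ c × y ≡ r)

Avoids : ∀ {n} (r c z : Fin n) → Set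
Avoids r c z = z ≢ r × z ≢ c

avoids⇒¬SamePair : ∀ {n} {x y r c : Fin n} → Avoids r c x ⊎ Avoids r c y → ¬ SamePair x y r c
avoids⇒¬SamePair (inj₁ (x≢r , _))   (inj₁ (x≡r , _)) = x≢r x≡r
avoids⇒¬SamePair (inj₁ (_ , x≢c))   (inj₂ (x≡c , _)) = x≢c x≡c
avoids⇒¬SamePair (inj₂ (_ , y≢c))   (inj₁ (_ , y≡c)) = y≢c y≡c
avoids⇒¬SamePair (inj₂ (y≢r , _))   (inj₂ (_ , y≡r)) = y≢r y≡r

SamePair-swap : ∀ {n} {x y r c : Fin n} → SamePair x y r c → SamePair y x r c
SamePair-swap (inj₁ (x≡r , y≡c)) = inj₂ (y≡c , x≡r)
SamePair-swap (inj₂ (x≡c , y≡r)) = inj₁ (y≡r , x≡c)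

uuEdge-< : ∀ {n} π U {x y : Fin n} → x Fin.< y → uuEdge π U x y ≡ π (U x y)
uuEdge-< π U {x} {y} x<y with x Fin.<? y | y Fin.<? x
... | yes _   | _ = refl
... | no  x≮y | _ = ⊥-elim (x≮y x<y)

uuEdge-> : ∀ {n} π U {x y : Fin n} → y Fin.< x → uuEdge π U x y ≡ π (U y x)
uuEdge-> π U {x} {y} y<x with x Fin.<? y | y Fin.<? x
... | yes x<y | _       = ⊥-elim (Finₚ.<-asym x<y y<x)
... | no  _   | yes _   = refl
... | no  _   | no  y≮x = ⊥-elim (y≮x y<x)

uuEdge-cong : ∀ {n} π {U U′ : Fin n → Fin n → Out} x y →
  U x y ≡ U′ x y → U y x ≡ U′ y x → uuEdge π U x y ≡ uuEdge π U′ x y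
uuEdge-cong π x y eq₁ eq₂ with x Fin.<? y | y Fin.<? x
... | yes _ | _     = cong π eq₁
... | no  _ | yes _ = cong π eq₂
... | no  _ | no  _ = refl

module _ {n m : ℕ} where

  -- The edge {x, y} is stored at (x, y) or at (y, x) depending on the order of x and y.
  AgreeOffᵘ : Fin n → Fin n → Config n m → Config n m → Set
  AgreeOffᵘ x y G G′ = (∀ r c → ¬ SamePair r c x y → proj₁ G r c ≡ proj₁ G′ r c) × proj₂ G ≡ proj₂ G′

  AgreeOffᵃ : Fin n → Fin m → Config n m → Config n m → Set
  AgreeOffᵃ x l G G′ = proj₁ G ≡ proj₁ G′ × AgreeExcept₂ x l (proj₂ G) (proj₂ G′)

  Ignores : (Config n m → Config n m → Set) → (Config n m → ℚ) → Set
  Ignores _~_ R = ∀ G G′ → G ~ G′ → R G ≡ R G′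

  Ignores-* : ∀ {_~_ R R′} → Ignores _~_ R → Ignores _~_ R′ → Ignores _~_ (λ G → R G * R′ G)
  Ignores-* ign ign′ G G′ G~G′ = cong₂ _*_ (ign G G′ G~G′) (ign′ G G′ G~G′)

  Ignores-ΠFin : ∀ {_~_} k {f : Fin k → Config n m → ℚ} →
    (∀ t → Ignores _~_ (f t)) → Ignores _~_ (λ G → ΠFin k (λ t → f t G))
  Ignores-ΠFin zero    ign G G′ G~G′ = refl
  Ignores-ΠFin (suc k) ign G G′ G~G′ =
    cong₂ _*_ (ign zero G G′ G~G′) (Ignores-ΠFin k (λ t → ign (suc t)) G G′ G~G′)

  module _ (θ : Params) where

    private
      μA : Fin n → Fin m → Dist
      μA _ _ = corrBern (qa θ) (ρa θ)
      LU : Linear (E₂ n n (μu (qu θ) (ρu θ)))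
      LU = Linear-E₂ n n (μu (qu θ) (ρu θ)) (μu-isProbability (qu θ) (ρu θ))
      LA : Linear (E₂ n m μA)
      LA = Linear-E₂ n m μA (λ _ _ → corrBern-isProbability (qa θ) (ρa θ))

    𝔼-factorᵘ : ∀ {x y r c} → r Fin.< c → SamePair r c x y → ∀ h {R} → Ignores (AgreeOffᵘ x y) R →
      𝔼 n m θ (λ G → h (proj₁ G r c) * R G) ≡ E₀ (corrBern (qu θ) (ρu θ)) h * 𝔼 n m θ R
    𝔼-factorᵘ {r = r} {c} r<c rc h {R} ign = begin
      E₂ n n μU (λ U → E₂ n m μA (λ A → h (U r c) * R (U , A)))
        ≡⟨ E-cong LU (λ U → E-scale LA (h (U r c)) _) ⟩
      E₂ n n μU (λ U → h (U r c) * R̄ U)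
        ≡⟨ E₂-factor n n μU (μu-isProbability _ _) r c h R̄ R̄-ignores ⟩
      E₀ (μU r c) h * E₂ n n μU R̄
        ≡⟨ cong (λ d → E₀ d h * E₂ n n μU R̄) (μu-< (qu θ) (ρu θ) r<c) ⟩
      E₀ (corrBern (qu θ) (ρu θ)) h * E₂ n n μU R̄
        ∎
      where
      open ≡-Reasoning
      μU : Fin n → Fin n → Dist
      μU = μu (qu θ) (ρu θ)
      R̄ : (Fin n → Fin n → Out) → ℚ
      R̄ U = E₂ n m μA (λ A → R (U , A))
      R̄-ignores : ∀ U U′ → AgreeExcept₂ r c U U′ → R̄ U ≡ R̄ U′
      R̄-ignores U U′ eq = E-cong LA (λ A → ign _ _ ((λ a b ¬ab → eq a b λ { (refl , refl) → ¬ab rc }) , refl))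

    𝔼-factorᵃ : ∀ {x l} h {R} → Ignores (AgreeOffᵃ x l) R →
      𝔼 n m θ (λ G → h (proj₂ G x l) * R G) ≡ E₀ (corrBern (qa θ) (ρa θ)) h * 𝔼 n m θ R
    𝔼-factorᵃ {x} {l} h {R} ign = trans
      (E-cong LU (λ U → E₂-factor n m μA (λ _ _ → corrBern-isProbability (qa θ) (ρa θ)) x l h (λ A → R (U , A))
                          (λ A A′ eq → ign _ _ (refl , eq))))
      (E-scale LU (E₀ (corrBern (qa θ) (ρa θ)) h) _)

    private
      L𝔼 : Linear (𝔼 n m θ)
      L𝔼 = Linear-𝔼 n m θ

    𝔼-factor-edge : ∀ {x y} → x ≢ y → (F : Bool.Bool → Bool.Bool → ℚ) → ∀ {R} → Ignores (AgreeOffᵘ x y) R →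
      𝔼 n m θ (λ G → F (uuEdge proj₁ (proj₁ G) x y) (uuEdge proj₂ (proj₁ G) x y) * R G)
        ≡ E₀ (corrBern (qu θ) (ρu θ)) (λ o → F (proj₁ o) (proj₂ o)) * 𝔼 n m θ R
    𝔼-factor-edge {x} {y} x≢y F {R} ign with Finₚ.<-cmp x y
    ... | tri< x<y _ _ = trans
      (E-cong L𝔼 (λ G → cong₂ (λ a b → F a b * R G) (uuEdge-< proj₁ (proj₁ G) x<y) (uuEdge-< proj₂ (proj₁ G) x<y)))
      (𝔼-factorᵘ x<y (inj₁ (refl , refl)) (λ o → F (proj₁ o) (proj₂ o)) ign)
    ... | tri≈ _ x≡y _ = ⊥-elim (x≢y x≡y)
    ... | tri> _ _ y<x = trans
      (E-cong L𝔼 (λ G → cong₂ (λ a b → F a b * R G) (uuEdge-> proj₁ (proj₁ G) y<x) (uuEdge-> proj₂ (proj₁ G) y<x)))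
      (𝔼-factorᵘ y<x (inj₂ (refl , refl)) (λ o → F (proj₁ o) (proj₂ o)) ign)

    𝔼-lone-edge : ∀ {x y} → x ≢ y → ∀ {R} → Ignores (AgreeOffᵘ x y) R →
      𝔼 n m θ (λ G → centU θ proj₁ G x y * R G) ≡ 0ℚ
    𝔼-lone-edge x≢y {R} ign = begin
      _                                                               ≡⟨ 𝔼-factor-edge x≢y (λ b _ → centred (qu θ) b) ign ⟩
      E₀ (corrBern (qu θ) (ρu θ)) (λ o → centred (qu θ) (proj₁ o)) * 𝔼 n m θ R
                                                                      ≡⟨ cong (_* 𝔼 n m θ R) (corrBern-mean (qu θ) (ρu θ)) ⟩
      0ℚ * 𝔼 n m θ R                                                  ≡⟨ ℚₚ.*-zeroˡ (𝔼 n m θ R) ⟩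
      0ℚ                                                              ∎
      where open ≡-Reasoning

    𝔼-shared-edge : ∀ {x y} → x ≢ y → ∀ {R} → Ignores (AgreeOffᵘ x y) R →
      𝔼 n m θ (λ G → (centU θ proj₁ G x y * centU θ proj₂ G x y) * R G) ≡ (ρu θ * σ² (qu θ)) * 𝔼 n m θ R
    𝔼-shared-edge x≢y {R} ign =
      trans (𝔼-factor-edge x≢y (λ b b′ → centred (qu θ) b * centred (qu θ) b′) ign)
            (cong (_* 𝔼 n m θ R) (corrBern-covariance (qu θ) (ρu θ)))

    𝔼-lone-attribute : ∀ {x l R} → Ignores (AgreeOffᵃ x l) R →
      𝔼 n m θ (λ G → centA θ proj₁ G x l * R G) ≡ 0ℚ
    𝔼-lone-attribute {R = R} ign = begin
      _                                                               ≡⟨ 𝔼-factorᵃ (λ o → centred (qa θ) (proj₁ o)) ign ⟩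
      E₀ (corrBern (qa θ) (ρa θ)) (λ o → centred (qa θ) (proj₁ o)) * 𝔼 n m θ R
                                                                      ≡⟨ cong (_* 𝔼 n m θ R) (corrBern-mean (qa θ) (ρa θ)) ⟩
      0ℚ * 𝔼 n m θ R                                                  ≡⟨ ℚₚ.*-zeroˡ (𝔼 n m θ R) ⟩
      0ℚ                                                              ∎
      where open ≡-Reasoning

    𝔼-shared-attribute : ∀ {x l R} → Ignores (AgreeOffᵃ x l) R →
      𝔼 n m θ (λ G → (centA θ proj₁ G x l * centA θ proj₂ G x l) * R G) ≡ (ρa θ * σ² (qa θ)) * 𝔼 n m θ R
    𝔼-shared-attribute {R = R} ign =
      trans (𝔼-factorᵃ (λ o → centred (qa θ) (proj₁ o) * centred (qa θ) (proj₂ o)) ign)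
            (cong (_* 𝔼 n m θ R) (corrBern-covariance (qa θ) (ρa θ)))

    centU-ignoresᵃ : ∀ π x y {r l} → Ignores (AgreeOffᵃ r l) (λ G → centU θ π G x y)
    centU-ignoresᵃ π x y _ _ (U≡U′ , _) = cong (λ U → centred (qu θ) (uuEdge π U x y)) U≡U′

    centA-ignoresᵘ : ∀ π x l {r c} → Ignores (AgreeOffᵘ r c) (λ G → centA θ π G x l)
    centA-ignoresᵘ π x l _ _ (_ , A≡A′) = cong (λ A → centred (qa θ) (π (A x l))) A≡A′

    centA-ignoresᵃ : ∀ π {x l r c} → ¬ (x ≡ r × l ≡ c) → Ignores (AgreeOffᵃ r c) (λ G → centA θ π G x l)
    centA-ignoresᵃ π {x} {l} xl≢rc _ _ (_ , agree) = cong (λ o → centred (qa θ) (π o)) (agree x l xl≢rc)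

    centU-ignoresᵘ : ∀ π x y {r c} → Avoids r c x ⊎ Avoids r c y → Ignores (AgreeOffᵘ r c) (λ G → centU θ π G x y)
    centU-ignoresᵘ π x y avoids _ _ (agree , _) = cong (centred (qu θ)) (uuEdge-cong π x y
      (agree x y (avoids⇒¬SamePair avoids))
      (agree y x (λ same → avoids⇒¬SamePair avoids (SamePair-swap same))))

    ωTree-ignores : ∀ {_~_} π x {k} (α : Fin k → Fin m) (u : Fin k → Fin n) →
      (∀ t → Ignores _~_ (λ G → centU θ π G x (u t))) → (∀ t → Ignores _~_ (λ G → centA θ π G (u t) (α t))) →
      Ignores _~_ (λ G → ωTree θ π G x α u)
    ωTree-ignores π x {k} α u ignU ignA = Ignores-ΠFin k (λ t → Ignores-* (ignU t) (ignA t))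

    ωTree-ignoresᵃ : ∀ π x {k} (α : Fin k → Fin m) (u : Fin k → Fin n) {r c} →
      (∀ t → ¬ (u t ≡ r × α t ≡ c)) → Ignores (AgreeOffᵃ r c) (λ G → ωTree θ π G x α u)
    ωTree-ignoresᵃ π x α u fresh =
      ωTree-ignores π x α u (λ t → centU-ignoresᵃ π x (u t)) (λ t → centA-ignoresᵃ π (fresh t))

    ωTree-ignoresᵘ : ∀ π x {k} (α : Fin k → Fin m) (u : Fin k → Fin n) {r c} →
      (∀ t → Avoids r c x ⊎ Avoids r c (u t)) → Ignores (AgreeOffᵘ r c) (λ G → ωTree θ π G x α u)
    ωTree-ignoresᵘ π x α u fresh =
      ωTree-ignores π x α u (λ t → centU-ignoresᵘ π x (u t) (fresh t)) (λ t → centA-ignoresᵘ π (u t) (α t))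

    ωPair : ∀ k → Fin n → Fin n → (Fin k → Fin m) → (Fin k → Fin n) → (Fin k → Fin n) → Config n m → ℚ
    ωPair k i j α u v G = ωTree θ proj₁ G i α u * ωTree θ proj₂ G j α v

    treeMoment : ℕ → ℚ
    treeMoment k = ((ρu θ * σ² (qu θ)) ^ℚ k) * ((ρa θ * σ² (qa θ)) ^ℚ k)

    𝔼-ωPair-heads≢ : ∀ {k} i j (α : Fin (suc k) → Fin m) u v → Injective α → u zero ≢ v zero →
      𝔼 n m θ (ωPair (suc k) i j α u v) ≡ 0ℚ
    𝔼-ωPair-heads≢ {k} i j α u v inj u₀≢v₀ = trans
      (E-cong L𝔼 (λ G → solve 6 (λ a₁ b₁ T₁ a₂ b₂ T₂ →
          (a₁ :* b₁) :* T₁ :* ((a₂ :* b₂) :* T₂) := b₁ :* (a₁ :* T₁ :* ((a₂ :* b₂) :* T₂))) refl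
        (a₁ G) (centA θ proj₁ G (u zero) (α zero)) (T₁ G) (a₂ G) (b₂ G) (T₂ G)))
      (𝔼-lone-attribute rest-ignores)
      where
      α′ : Fin k → Fin m
      α′ t = α (suc t)
      a₁ a₂ b₂ T₁ T₂ : Config n m → ℚ
      a₁ G = centU θ proj₁ G i (u zero)
      T₁ G = ωTree θ proj₁ G i α′ (λ t → u (suc t))
      a₂ G = centU θ proj₂ G j (v zero)
      b₂ G = centA θ proj₂ G (v zero) (α zero)
      T₂ G = ωTree θ proj₂ G j α′ (λ t → v (suc t))
      α′-fresh : ∀ {w : Fin k → Fin n} t → ¬ (w t ≡ u zero × α′ t ≡ α zero)
      α′-fresh t (_ , eq) = Injective-head inj t eq
      rest-ignores : Ignores (AgreeOffᵃ (u zero) (α zero)) (λ G → a₁ G * T₁ G * ((a₂ G * b₂ G) * T₂ G))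
      rest-ignores = Ignores-*
        (Ignores-* (centU-ignoresᵃ proj₁ i (u zero)) (ωTree-ignoresᵃ proj₁ i α′ (λ t → u (suc t)) α′-fresh))
        (Ignores-* (Ignores-* (centU-ignoresᵃ proj₂ j (v zero))
                              (centA-ignoresᵃ proj₂ (λ (eq , _) → u₀≢v₀ (sym eq))))
                   (ωTree-ignoresᵃ proj₂ j α′ (λ t → v (suc t)) α′-fresh))

    𝔼-ωPair-roots≢ : ∀ {k} i j (α : Fin (suc k) → Fin m) u v → i ≢ j → u zero ≡ v zero →
      TreeChoice i u → TreeChoice j v → 𝔼 n m θ (ωPair (suc k) i j α u v) ≡ 0ℚ
    𝔼-ωPair-roots≢ {k} i j α u v i≢j u₀≡v₀ (u-inj , u-avoids) (_ , v-avoids) = trans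
      (E-cong L𝔼 (λ G → solve 6 (λ a₁ b₁ T₁ a₂ b₂ T₂ →
          (a₁ :* b₁) :* T₁ :* ((a₂ :* b₂) :* T₂) := a₁ :* (b₁ :* T₁ :* ((a₂ :* b₂) :* T₂))) refl
        (centU θ proj₁ G i (u zero)) (b₁ G) (T₁ G) (a₂ G) (b₂ G) (T₂ G)))
      (𝔼-lone-edge (λ eq → u-avoids zero (sym eq)) rest-ignores)
      where
      α′ : Fin k → Fin m
      α′ t = α (suc t)
      b₁ a₂ b₂ T₁ T₂ : Config n m → ℚ
      b₁ G = centA θ proj₁ G (u zero) (α zero)
      T₁ G = ωTree θ proj₁ G i α′ (λ t → u (suc t))
      a₂ G = centU θ proj₂ G j (v zero)
      b₂ G = centA θ proj₂ G (v zero) (α zero)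
      T₂ G = ωTree θ proj₂ G j α′ (λ t → v (suc t))
      j-avoids : Avoids i (u zero) j
      j-avoids = (λ eq → i≢j (sym eq)) , (λ eq → v-avoids zero (trans (sym u₀≡v₀) (sym eq)))
      rest-ignores : Ignores (AgreeOffᵘ i (u zero)) (λ G → b₁ G * T₁ G * ((a₂ G * b₂ G) * T₂ G))
      rest-ignores = Ignores-*
        (Ignores-* (centA-ignoresᵘ proj₁ (u zero) (α zero))
                   (ωTree-ignoresᵘ proj₁ i α′ (λ t → u (suc t))
                      (λ t → inj₂ (u-avoids (suc t) , Injective-head u-inj t))))
        (Ignores-* (Ignores-* (centU-ignoresᵘ proj₂ j (v zero) (inj₁ j-avoids))
                              (centA-ignoresᵘ proj₂ (v zero) (α zero)))
                   (ωTree-ignoresᵘ proj₂ j α′ (λ t → v (suc t)) (λ _ → inj₁ j-avoids)))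

    𝔼-ωPair-diagonal : ∀ k i (α : Fin k → Fin m) u v → Injective α → TreeChoice i u → TreeChoice i v →
      𝔼 n m θ (ωPair k i i α u v) ≡ ΠFin k (λ t → 𝟙 (u t ≟ v t)) * treeMoment k
    𝔼-ωPair-diagonal zero    i α u v _ _ _ = E-const L𝔼 (1ℚ * 1ℚ)
    𝔼-ωPair-diagonal (suc k) i α u v α-inj tu@(u-inj , u-avoids) tv@(v-inj , v-avoids) with u zero ≟ v zero
    ... | no u₀≢v₀ = begin
      𝔼 n m θ (ωPair (suc k) i i α u v)  ≡⟨ 𝔼-ωPair-heads≢ i i α u v α-inj u₀≢v₀ ⟩
      0ℚ                                 ≡⟨ ℚₚ.*-zeroˡ (treeMoment (suc k)) ⟨
      0ℚ * treeMoment (suc k)            ≡⟨ cong (_* treeMoment (suc k)) (ℚₚ.*-zeroˡ (Π′ v′)) ⟨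
      (0ℚ * Π′ v′) * treeMoment (suc k)  ∎
      where
      open ≡-Reasoning
      v′ : Fin k → Fin n
      v′ t = v (suc t)
      Π′ : (Fin k → Fin n) → ℚ
      Π′ w = ΠFin k (λ t → 𝟙 (u (suc t) ≟ w t))
    ... | yes u₀≡v₀ = begin
      𝔼 n m θ (ωPair (suc k) i i α u v)
        ≡⟨ E-cong L𝔼 regroup ⟩
      𝔼 n m θ (λ G → (centA θ proj₁ G (u zero) (α zero) * centA θ proj₂ G (u zero) (α zero)) * R G)
        ≡⟨ 𝔼-shared-attribute R-ignoresᵃ ⟩
      covᵃ * 𝔼 n m θ R
        ≡⟨ cong (covᵃ *_) (𝔼-shared-edge (λ eq → u-avoids zero (sym eq)) R′-ignoresᵘ) ⟩
      covᵃ * (covᵘ * 𝔼 n m θ (ωPair k i i α′ u′ v′))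
        ≡⟨ cong (λ z → covᵃ * (covᵘ * z))
                (𝔼-ωPair-diagonal k i α′ u′ v′ (Injective-tail α-inj) (TreeChoice-tail tu) (TreeChoice-tail tv)) ⟩
      covᵃ * (covᵘ * (ΠFin k (λ t → 𝟙 (u′ t ≟ v′ t)) * ((covᵘ ^ℚ k) * (covᵃ ^ℚ k))))
        ≡⟨ solve 5 (λ A U P Uk Ak → A :* (U :* (P :* (Uk :* Ak))) := (con 1ℚ :* P) :* ((U :* Uk) :* (A :* Ak))) refl
             covᵃ covᵘ (ΠFin k (λ t → 𝟙 (u′ t ≟ v′ t))) (covᵘ ^ℚ k) (covᵃ ^ℚ k) ⟩
      (1ℚ * ΠFin k (λ t → 𝟙 (u′ t ≟ v′ t))) * treeMoment (suc k)
        ∎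
      where
      open ≡-Reasoning
      covᵘ covᵃ : ℚ
      covᵘ = ρu θ * σ² (qu θ)
      covᵃ = ρa θ * σ² (qa θ)
      α′ : Fin k → Fin m
      α′ t = α (suc t)
      u′ v′ : Fin k → Fin n
      u′ t = u (suc t)
      v′ t = v (suc t)
      R : Config n m → ℚ
      R G = (centU θ proj₁ G i (u zero) * centU θ proj₂ G i (u zero)) * ωPair k i i α′ u′ v′ G
      regroup : ∀ G → ωPair (suc k) i i α u v G
                    ≡ (centA θ proj₁ G (u zero) (α zero) * centA θ proj₂ G (u zero) (α zero)) * R G
      firstPath₂ : Config n m → Fin n → ℚ
      firstPath₂ G w = centU θ proj₂ G i w * centA θ proj₂ G w (α zero)
      regroup G = trans
        (cong (λ w → ωTree θ proj₁ G i α u * (firstPath₂ G w * ωTree θ proj₂ G i α′ v′)) (sym u₀≡v₀))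
        (solve 6 (λ a₁ b₁ T₁ a₂ b₂ T₂ →
            (a₁ :* b₁) :* T₁ :* ((a₂ :* b₂) :* T₂) := (b₁ :* b₂) :* ((a₁ :* a₂) :* (T₁ :* T₂))) refl
           (centU θ proj₁ G i (u zero)) (centA θ proj₁ G (u zero) (α zero)) (ωTree θ proj₁ G i α′ u′)
           (centU θ proj₂ G i (u zero)) (centA θ proj₂ G (u zero) (α zero)) (ωTree θ proj₂ G i α′ v′))
      α′-fresh : ∀ {w : Fin k → Fin n} t → ¬ (w t ≡ u zero × α′ t ≡ α zero)
      α′-fresh t (_ , eq) = Injective-head α-inj t eq
      R-ignoresᵃ : Ignores (AgreeOffᵃ (u zero) (α zero)) R
      R-ignoresᵃ = Ignores-* (Ignores-* (centU-ignoresᵃ proj₁ i (u zero)) (centU-ignoresᵃ proj₂ i (u zero)))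
        (Ignores-* (ωTree-ignoresᵃ proj₁ i α′ u′ α′-fresh) (ωTree-ignoresᵃ proj₂ i α′ v′ α′-fresh))
      R′-ignoresᵘ : Ignores (AgreeOffᵘ i (u zero)) (ωPair k i i α′ u′ v′)
      R′-ignoresᵘ = Ignores-*
        (ωTree-ignoresᵘ proj₁ i α′ u′ (λ t → inj₂ (u-avoids (suc t) , Injective-head u-inj t)))
        (ωTree-ignoresᵘ proj₂ i α′ v′ (λ t → inj₂ (v-avoids (suc t) , λ eq → Injective-head v-inj t (trans eq u₀≡v₀))))

    treePairTerm : ∀ k → Fin n → Fin n → (Fin k → Fin m) → (Fin k → Fin n) → (Fin k → Fin n) → ℚ
    treePairTerm k i j α u v = 𝟙 (treeChoice? i u) * (𝟙 (treeChoice? j v) * 𝔼 n m θ (ωPair k i j α u v))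

    𝔼-WW : ∀ k i j α → 𝔼 n m θ (λ G → W k θ proj₁ G i α * W k θ proj₂ G j α)
      ≡ ΣFun k n (λ u → ΣFun k n (treePairTerm k i j α u))
    𝔼-WW k i j α = begin
      𝔼 n m θ (λ G → W k θ proj₁ G i α * W k θ proj₂ G j α)    ≡⟨ E-cong L𝔼 (λ G → ΣFun-*-ΣFun k n _ _) ⟩
      𝔼 n m θ (λ G → ΣFun k n (λ u → ΣFun k n (λ v → term u v G))) ≡⟨ E-ΣFun L𝔼 k n _ ⟩
      ΣFun k n (λ u → 𝔼 n m θ (λ G → ΣFun k n (λ v → term u v G))) ≡⟨ ΣFun-cong k n (λ u → E-ΣFun L𝔼 k n _) ⟩
      ΣFun k n (λ u → ΣFun k n (λ v → 𝔼 n m θ (term u v)))         ≡⟨ ΣFun-cong k n (λ u → ΣFun-cong k n (pull-out u)) ⟩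
      ΣFun k n (λ u → ΣFun k n (treePairTerm k i j α u))            ∎
      where
      open ≡-Reasoning
      term : (Fin k → Fin n) → (Fin k → Fin n) → Config n m → ℚ
      term u v G = (𝟙 (treeChoice? i u) * ωTree θ proj₁ G i α u) * (𝟙 (treeChoice? j v) * ωTree θ proj₂ G j α v)
      pull-out : ∀ u v → 𝔼 n m θ (term u v) ≡ treePairTerm k i j α u v
      pull-out u v = begin
        _ ≡⟨ E-cong L𝔼 (λ G → solve 4 (λ a x b y → (a :* x) :* (b :* y) := a :* (b :* (x :* y))) refl
                                 (𝟙 (treeChoice? i u)) (ωTree θ proj₁ G i α u) (𝟙 (treeChoice? j v)) (ωTree θ proj₂ G j α v)) ⟩
        _ ≡⟨ E-scale L𝔼 (𝟙 (treeChoice? i u)) _ ⟩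
        _ ≡⟨ cong (𝟙 (treeChoice? i u) *_) (E-scale L𝔼 (𝟙 (treeChoice? j v)) _) ⟩
        _ ∎

    𝔼-WW-offdiagonal : ∀ k i j (α : Fin (suc k) → Fin m) → i ≢ j → Injective α →
      𝔼 n m θ (λ G → W (suc k) θ proj₁ G i α * W (suc k) θ proj₂ G j α) ≡ 0ℚ
    𝔼-WW-offdiagonal k i j α i≢j α-inj = trans (𝔼-WW (suc k) i j α)
      (ΣFun-zero (suc k) n λ u → ΣFun-zero (suc k) n λ v →
        𝟙-*-vanishes (treeChoice? i u) λ tu → 𝟙-*-vanishes (treeChoice? j v) λ tv → vanishes u v tu tv)
      where
      vanishes : ∀ u v → TreeChoice i u → TreeChoice j v → 𝔼 n m θ (ωPair (suc k) i j α u v) ≡ 0ℚ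
      vanishes u v tu tv with u zero ≟ v zero
      ... | no  u₀≢v₀ = 𝔼-ωPair-heads≢ i j α u v α-inj u₀≢v₀
      ... | yes u₀≡v₀ = 𝔼-ωPair-roots≢ i j α u v i≢j u₀≡v₀ tu tv

    𝔼-WW-diagonal : ∀ k i (α : Fin k → Fin m) → Injective α →
      𝔼 n m θ (λ G → W k θ proj₁ G i α * W k θ proj₂ G i α) ≡ ℕ→ℚ ((n ∸ 1) P′ k) * treeMoment k
    𝔼-WW-diagonal k i α α-inj = begin
      _ ≡⟨ 𝔼-WW k i i α ⟩
      ΣFun k n (λ u → ΣFun k n (treePairTerm k i i α u))
        ≡⟨ ΣFun-cong k n (λ u → trans (ΣFun-scale k n (𝟙 (treeChoice? i u)) _)
                                      (𝟙-*-cong (treeChoice? i u) (Σ-partners u))) ⟩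
      ΣFun k n (λ u → 𝟙 (treeChoice? i u) * treeMoment k)
        ≡⟨ ΣFun-scaleʳ k n (treeMoment k) _ ⟩
      ΣFun k n (λ u → 𝟙 (treeChoice? i u)) * treeMoment k
        ≡⟨ cong (_* treeMoment k) (ΣFun-treeChoice n k i) ⟩
      ℕ→ℚ ((n ∸ 1) P′ k) * treeMoment k
        ∎
      where
      open ≡-Reasoning
      agree : (Fin k → Fin n) → (Fin k → Fin n) → ℚ
      agree u v = ΠFin k (λ t → 𝟙 (u t ≟ v t))
      partner : ∀ u → TreeChoice i u → ∀ v (dv : Dec (TreeChoice i v)) →
        𝟙 dv * 𝔼 n m θ (ωPair k i i α u v) ≡ agree u v * treeMoment k
      partner u tu v (yes tv) = trans (ℚₚ.*-identityˡ _) (𝔼-ωPair-diagonal k i α u v α-inj tu tv)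
      partner u tu v (no ¬tv) = begin
        0ℚ * 𝔼 n m θ (ωPair k i i α u v)  ≡⟨ ℚₚ.*-zeroˡ (𝔼 n m θ (ωPair k i i α u v)) ⟩
        0ℚ                                ≡⟨ ℚₚ.*-zeroˡ (treeMoment k) ⟨
        0ℚ * treeMoment k                 ≡⟨ cong (_* treeMoment k) (proj₂ (ΠFin-𝟙≟-isIndicatorOf k u v) u≢v) ⟨
        agree u v * treeMoment k          ∎
        where
        u≢v : ¬ (∀ t → u t ≡ v t)
        u≢v u≗v = ¬tv (TreeChoice-≗ u≗v tu)
      Σ-partners : ∀ u → TreeChoice i u →
        ΣFun k n (λ v → 𝟙 (treeChoice? i v) * 𝔼 n m θ (ωPair k i i α u v)) ≡ treeMoment k
      Σ-partners u tu = begin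
        _                                          ≡⟨ ΣFun-cong k n (λ v → partner u tu v (treeChoice? i v)) ⟩
        ΣFun k n (λ v → agree u v * treeMoment k)  ≡⟨ ΣFun-scaleʳ k n (treeMoment k) (agree u) ⟩
        ΣFun k n (agree u) * treeMoment k          ≡⟨ cong (_* treeMoment k) (ΣFun-ΠFin-𝟙≟ k n u) ⟩
        1ℚ * treeMoment k                          ≡⟨ ℚₚ.*-identityˡ (treeMoment k) ⟩
        treeMoment k                               ∎

    𝔼-Φ : ∀ k i j → 𝔼 n m θ (Φ k θ i j)
      ≡ ΣFun k m (λ α → 𝟙 (increasing? α) * 𝔼 n m θ (λ G → W k θ proj₁ G i α * W k θ proj₂ G j α))
    𝔼-Φ k i j = trans (E-ΣFun L𝔼 k m _) (ΣFun-cong k m (λ α → E-scale L𝔼 (𝟙 (increasing? α)) _))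

    𝔼-Φ-offdiagonal : ∀ k {i j} → i ≢ j → 𝔼 n m θ (Φ (suc k) θ i j) ≡ 0ℚ
    𝔼-Φ-offdiagonal k {i} {j} i≢j = trans (𝔼-Φ (suc k) i j) (ΣFun-zero (suc k) m λ α →
      𝟙-*-vanishes (increasing? α) λ inc → 𝔼-WW-offdiagonal k i j α i≢j (Increasing⇒Injective inc))

    𝔼-Φ-diagonal : ∀ k i → 𝔼 n m θ (Φ k θ i i) ≡ ℕ→ℚ (m C k) * (ℕ→ℚ ((n ∸ 1) P′ k) * treeMoment k)
    𝔼-Φ-diagonal k i = begin
      _ ≡⟨ 𝔼-Φ k i i ⟩
      _ ≡⟨ ΣFun-cong k m (λ α → 𝟙-*-cong (increasing? α) λ inc →
             𝔼-WW-diagonal k i α (Increasing⇒Injective inc)) ⟩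
      _ ≡⟨ ΣFun-scaleʳ k m _ _ ⟩
      _ ≡⟨ cong (_* (ℕ→ℚ ((n ∸ 1) P′ k) * treeMoment k)) (ΣFun-increasing m k) ⟩
      _ ∎
      where open ≡-Reasoning


-- The expectation of Φ

𝔼-Φ-formula : ∀ n m k → .{{NonZero k}} → ∀ qu ρu qa ρa (i j : Fin n) →
  𝔼 n m (params qu ρu qa ρa) (Φ k (params qu ρu qa ρa) i j)
    ≡ ℕ→ℚ (m C k) * ((ρu * σ² qu) ^ℚ k) * ((ρa * σ² qa) ^ℚ k)
      * ℕ→ℚ ((n ∸ 1) C k) * ℕ→ℚ (k !) * 𝟙 (i ≟ j)
𝔼-Φ-formula n m k@(suc k′) qu ρu qa ρa i j with i ≟ j
... | no i≢j = trans (𝔼-Φ-offdiagonal (params qu ρu qa ρa) k′ i≢j)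
  (sym (ℚₚ.*-zeroʳ (ℕ→ℚ (m C k) * ((ρu * σ² qu) ^ℚ k) * ((ρa * σ² qa) ^ℚ k)
                    * ℕ→ℚ ((n ∸ 1) C k) * ℕ→ℚ (k !))))
... | yes refl = begin
  _                                                 ≡⟨ 𝔼-Φ-diagonal (params qu ρu qa ρa) k i ⟩
  ℕ→ℚ (m C k) * (ℕ→ℚ ((n ∸ 1) P′ k) * (A * B))      ≡⟨ cong (λ x → ℕ→ℚ (m C k) * (x * (A * B))) P′≡C*! ⟩
  ℕ→ℚ (m C k) * ((ℕ→ℚ ((n ∸ 1) C k) * ℕ→ℚ (k !)) * (A * B))
    ≡⟨ solve 5 (λ c x f a b → c :* ((x :* f) :* (a :* b)) := c :* a :* b :* x :* f :* con 1ℚ) refl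
         (ℕ→ℚ (m C k)) (ℕ→ℚ ((n ∸ 1) C k)) (ℕ→ℚ (k !)) A B ⟩
  ℕ→ℚ (m C k) * A * B * ℕ→ℚ ((n ∸ 1) C k) * ℕ→ℚ (k !) * 1ℚ ∎
  where
  open ≡-Reasoning
  A B : ℚ
  A = (ρu * σ² qu) ^ℚ k
  B = (ρa * σ² qa) ^ℚ k
  P′≡C*! : ℕ→ℚ ((n ∸ 1) P′ k) ≡ ℕ→ℚ ((n ∸ 1) C k) * ℕ→ℚ (k !)
  P′≡C*! = trans (cong ℕ→ℚ (sym (C*!≡P′ (n ∸ 1) k))) (ℕ→ℚ-homo-* ((n ∸ 1) C k) (k !))

lowerBoundFactor : ℕ → ℕ
lowerBoundFactor k = 2 ℕ.^ k ℕ.* 2 ℕ.^ k ℕ.* k !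

^*^≤lowerBoundFactor : ∀ k n m → 2 ℕ.* k ℕ.≤ n → 2 ℕ.* k ℕ.≤ m →
  m ℕ.^ k ℕ.* n ℕ.^ k ℕ.≤ lowerBoundFactor k ℕ.* ((m C k) ℕ.* ((n ∸ 1) P′ k))
^*^≤lowerBoundFactor k n m 2k≤n 2k≤m = ℕₚ.≤-trans (ℕₚ.*-mono-≤ m-bound n-bound)
  (ℕₚ.≤-reflexive (trans (cong (λ p → (2 ℕ.^ k ℕ.* p) ℕ.* (2 ℕ.^ k ℕ.* ((n ∸ 1) P′ k))) (sym (C*!≡P′ m k)))
                         (regroup (2 ℕ.^ k) (m C k) (k !) ((n ∸ 1) P′ k))))
  where
  regroup : ∀ a c f p → (a ℕ.* (c ℕ.* f)) ℕ.* (a ℕ.* p) ≡ (a ℕ.* a ℕ.* f) ℕ.* (c ℕ.* p)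
  regroup = ℕ-Ring.solve-∀
  m-bound : m ℕ.^ k ℕ.≤ 2 ℕ.^ k ℕ.* (m P′ k)
  m-bound = ^≤2^*P′ m m k (λ t t<k → ≤-2*∸ t (ℕₚ.≤-trans (ℕₚ.*-monoʳ-≤ 2 (ℕₚ.<⇒≤ t<k)) 2k≤m))
  n-bound : n ℕ.^ k ℕ.≤ 2 ℕ.^ k ℕ.* ((n ∸ 1) P′ k)
  n-bound = ^≤2^*P′ n (n ∸ 1) k (λ t t<k → subst (λ x → n ℕ.≤ 2 ℕ.* x) (sym (ℕₚ.∸-+-assoc n 1 t))
                                                   (≤-2*∸ (suc t) (ℕₚ.≤-trans (ℕₚ.*-monoʳ-≤ 2 t<k) 2k≤n)))

module _ (k : ℕ) where

  private instance
    factor-positive : ℚ.Positive (ℕ→ℚ (lowerBoundFactor k))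
    factor-positive =
      ℕ→ℚ-positive (ℕₚ.*-mono-≤ (ℕₚ.*-mono-≤ (ℕₚ.m^n>0 2 k) (ℕₚ.m^n>0 2 k)) (ℕₚ.1≤n! k))
    factor-nonZero : ℚ.NonZero (ℕ→ℚ (lowerBoundFactor k))
    factor-nonZero = ℚₚ.pos⇒nonZero (ℕ→ℚ (lowerBoundFactor k))

  lowerBoundConstant : ℚ
  lowerBoundConstant = 1/ ℕ→ℚ (lowerBoundFactor k)

  private instance
    constant-positive : ℚ.Positive lowerBoundConstant
    constant-positive = ℚₚ.1/pos⇒pos (ℕ→ℚ (lowerBoundFactor k))

  lowerBoundConstant-positive : 0ℚ < lowerBoundConstant
  lowerBoundConstant-positive = ℚₚ.positive⁻¹ lowerBoundConstant

  lowerBoundConstant-scale : ∀ {p q} → p ℕ.≤ lowerBoundFactor k ℕ.* q →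
    lowerBoundConstant * ℕ→ℚ p ≤ ℕ→ℚ q
  lowerBoundConstant-scale {p} {q} p≤Dq = begin
    c * ℕ→ℚ p            ≤⟨ ℚₚ.*-monoˡ-≤-nonNeg c {{ℚₚ.pos⇒nonNeg c}} (ℕ→ℚ-mono-≤ p≤Dq) ⟩
    c * ℕ→ℚ (D ℕ.* q)    ≡⟨ cong (c *_) (ℕ→ℚ-homo-* D q) ⟩
    c * (ℕ→ℚ D * ℕ→ℚ q)  ≡⟨ ℚₚ.*-assoc c (ℕ→ℚ D) (ℕ→ℚ q) ⟨
    (c * ℕ→ℚ D) * ℕ→ℚ q  ≡⟨ cong (_* ℕ→ℚ q) (ℚₚ.*-inverseˡ (ℕ→ℚ D)) ⟩
    1ℚ * ℕ→ℚ q           ≡⟨ ℚₚ.*-identityˡ (ℕ→ℚ q) ⟩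
    ℕ→ℚ q                ∎
    where
    open ℚₚ.≤-Reasoning
    c : ℚ
    c = lowerBoundConstant
    D : ℕ
    D = lowerBoundFactor k

𝔼-Φ-diagonal-lower-bound : ∀ k n m → 2 ℕ.* k ℕ.≤ n → 2 ℕ.* k ℕ.≤ m → ∀ qu ρu qa ρa (i : Fin n) →
  lowerBoundConstant k * ℕ→ℚ m ^ℚ k * ℕ→ℚ n ^ℚ k * ∣ ((ρu * σ² qu) ^ℚ k) * ((ρa * σ² qa) ^ℚ k) ∣
    ≤ ∣ 𝔼 n m (params qu ρu qa ρa) (Φ k (params qu ρu qa ρa) i i) ∣
𝔼-Φ-diagonal-lower-bound k n m 2k≤n 2k≤m qu ρu qa ρa i = begin
  c * ℕ→ℚ m ^ℚ k * ℕ→ℚ n ^ℚ k * ∣ AB ∣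
    ≡⟨ cong (_* ∣ AB ∣) (trans (ℚₚ.*-assoc c _ _) (cong (c *_) powers)) ⟩
  c * ℕ→ℚ (m ℕ.^ k ℕ.* n ℕ.^ k) * ∣ AB ∣
    ≤⟨ ℚₚ.*-monoʳ-≤-nonNeg ∣ AB ∣ {{ℚₚ.∣-∣-nonNeg AB}}
         (lowerBoundConstant-scale k (^*^≤lowerBoundFactor k n m 2k≤n 2k≤m)) ⟩
  ℕ→ℚ Q * ∣ AB ∣
    ≡⟨ cong (_* ∣ AB ∣) (ℚₚ.0≤p⇒∣p∣≡p (ℕ→ℚ-mono-≤ {0} {Q} ℕ.z≤n)) ⟨
  ∣ ℕ→ℚ Q ∣ * ∣ AB ∣
    ≡⟨ ℚₚ.∣p*q∣≡∣p∣*∣q∣ (ℕ→ℚ Q) AB ⟨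
  ∣ ℕ→ℚ Q * AB ∣
    ≡⟨ cong ∣_∣ expectation ⟨
  ∣ 𝔼 n m (params qu ρu qa ρa) (Φ k (params qu ρu qa ρa) i i) ∣
    ∎
  where
  open ℚₚ.≤-Reasoning
  c AB : ℚ
  c = lowerBoundConstant k
  AB = ((ρu * σ² qu) ^ℚ k) * ((ρa * σ² qa) ^ℚ k)
  Q : ℕ
  Q = (m C k) ℕ.* ((n ∸ 1) P′ k)
  powers : ℕ→ℚ m ^ℚ k * ℕ→ℚ n ^ℚ k ≡ ℕ→ℚ (m ℕ.^ k ℕ.* n ℕ.^ k)
  powers = trans (cong₂ _*_ (ℕ→ℚ-homo-^ m k) (ℕ→ℚ-homo-^ n k)) (sym (ℕ→ℚ-homo-* (m ℕ.^ k) (n ℕ.^ k)))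
  expectation : 𝔼 n m (params qu ρu qa ρa) (Φ k (params qu ρu qa ρa) i i) ≡ ℕ→ℚ Q * AB
  expectation = begin-equality
    _                                              ≡⟨ 𝔼-Φ-diagonal (params qu ρu qa ρa) k i ⟩
    ℕ→ℚ (m C k) * (ℕ→ℚ ((n ∸ 1) P′ k) * AB)        ≡⟨ ℚₚ.*-assoc (ℕ→ℚ (m C k)) (ℕ→ℚ ((n ∸ 1) P′ k)) AB ⟨
    (ℕ→ℚ (m C k) * ℕ→ℚ ((n ∸ 1) P′ k)) * AB        ≡⟨ cong (_* AB) (ℕ→ℚ-homo-* (m C k) ((n ∸ 1) P′ k)) ⟨
    ℕ→ℚ Q * AB                                     ∎

proposition1 :
    ((n m k : ℕ) → .{{_ : NonZero k}} → (qu ρu qa ρa : ℚ) →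
      ValidParams qu ρu → ValidParams qa ρa → (i j : Fin n) →
      𝔼 n m (params qu ρu qa ρa) (Φ k (params qu ρu qa ρa) i j)
        ≡ ℕ→ℚ (m C k) * ((ρu * σ² qu) ^ℚ k) * ((ρa * σ² qa) ^ℚ k)
          * ℕ→ℚ ((n ∸ 1) C k) * ℕ→ℚ (k !) * 𝟙 (i ≟ j))
    ×
    ((k : ℕ) → .{{_ : NonZero k}} →
      Σ ℚ (λ c → (0ℚ < c) × Σ ℕ (λ N →
        (n m : ℕ) → n ≥ N → m ≥ N → (qu ρu qa ρa : ℚ) →
        ValidParams qu ρu → ValidParams qa ρa → (i : Fin n) →
        c * ℕ→ℚ m ^ℚ k * ℕ→ℚ n ^ℚ k * ∣ ((ρu * σ² qu) ^ℚ k) * ((ρa * σ² qa) ^ℚ k) ∣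
          ≤ ∣ 𝔼 n m (params qu ρu qa ρa) (Φ k (params qu ρu qa ρa) i i) ∣)))
proposition1 =
  (λ n m k qu ρu qa ρa _ _ i j → 𝔼-Φ-formula n m k qu ρu qa ρa i j) ,
  (λ k → lowerBoundConstant k , lowerBoundConstant-positive k , 2 ℕ.* k ,
         λ n m 2k≤n 2k≤m qu ρu qa ρa _ _ i → 𝔼-Φ-diagonal-lower-bound k n m 2k≤n 2k≤m qu ρu qa ρa i)
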